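{- Let $a\in\{0,1\}$, $b=1-a$, and let $x\in\{0,1\}^\omega$ be a Sturmian word of type $a$ with $\mathrm{card}(UP(x))<+\infty$. Then: (i) If $N(x)=2$, there exists a Sturmian word $y\in\{0,1\}^\omega$ word isomorphic to $\delta(x)$ such that $x=L_a(y)$. (ii) If $N(x)>2$ and $x$ begins with $a$, there exists a Sturmian word $y\in\{0,1\}^\omega$ beginning with $a$ such that $x=L_a(y)$, $N(y)<N(x)$ and $\delta(x)=\delta(y)$; moreover $L_a$ restricts to a bijection from $UP(y)$ onto $UP(x)$. (iii) If $N(x)>2$ and $x$ begins with $b$, there exists a Sturmian word $y\in\{0,1\}^\omega$ beginning with $b$ such that $x=R_a(y)$, $N(y)<N(x)$ and $\delta(x)=\delta(y)$; moreover $R_a$ restricts to a bijection from $UP(y)$ onto $UP(x)\setminus\{b\}$.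
   Context: A word $x\in\{0,1\}^\omega$ is Sturmian if it is aperiodic (not ultimately periodic) and balanced: for all factors $u,v$ with $|u|=|v|$, $||u|_c-|v|_c|\le1$ for $c\in\{0,1\}$. A Sturmian word is of type $a$ if it contains the factor $aa$. A finite non-empty word is unbordered if no non-empty word other than itself is both a prefix and a suffix of it; $UP(x)$ is the set of non-empty unbordered prefixes of $x$; if $UP(x)$ is finite, $N(x)$ is the length of the longest unbordered prefix of $x$. If $UP(x)$ is finite, $x$ has a unique factorization $x=U_0U_1\cdots$ with $U_i\in UP(x)$; with $UP'(x)=\{U_i:i\ge0\}$, $n_x=\mathrm{card}(UP'(x))$, $UP'(x)$ ordered by index of first occurrence in this factorization, and $\phi:\{1,\dots,n_x\}\to UP'(x)$ the order-preserving bijection, the derived word is $\delta(x)=\phi^{ -1}(U_0)\phi^{ -1}(U_1)\cdots$. $L_a$ and $R_a$ are the endomorphisms of $\{0,1\}^*$ (extended to infinite words) given by $L_a: a\mapsto a,\ b\mapsto ab$ and $R_a: a\mapsto a,\ b\mapsto ba$. Two words are word isomorphic if one is obtained from the other by applying a bijection between their alphabets letter by letter. -}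

module Defs where

open import Data.Bool using (Bool; true; false; not; if_then_else_)
open import Data.Bool.Properties using () renaming (_≟_ to _≟ᵇ_)
open import Data.Nat using (ℕ; zero; suc; _+_; _≤_; _<_; ∣_-_∣)
open import Data.Nat.Properties using (_≟_)
open import Data.List using (List; []; _∷_; _++_; [_]; length; concatMap; map; upTo; deduplicate)
open import Data.Product using (Σ; ∃; ∃-syntax; _×_; _,_)
open import Data.Empty using (⊥)
open import Relation.Nullary using (¬_; yes; no)
open import Relation.Binary.PropositionalEquality using (_≡_; _≢_)
open import Function using (_∘_)
open import Function.Definitions using (Injective)

Word : Set
Word = ℕ → Bool

pref : Word → ℕ → List Bool
pref x zero = []
pref x (suc n) = x 0 ∷ pref (x ∘ suc) n

fac : Word → ℕ → ℕ → List Bool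
fac x i n = pref (λ k → x (i + k)) n

count : Bool → List Bool → ℕ
count c [] = 0
count c (d ∷ w) with c ≟ᵇ d
... | yes _ = suc (count c w)
... | no  _ = count c w

Balanced : Word → Set
Balanced x = ∀ (c : Bool) (i j n : ℕ) → ∣ count c (fac x i n) - count c (fac x j n) ∣ ≤ 1

UltimatelyPeriodic : Word → Set
UltimatelyPeriodic x = ∃[ p ] (0 < p × ∃[ m ] (∀ n → m ≤ n → x (n + p) ≡ x n))

Sturmian : Word → Set
Sturmian x = ¬ UltimatelyPeriodic x × Balanced x

-- Sturmian word of type a: contains the factor aa
ContainsSquareOf : Bool → Word → Set
ContainsSquareOf a x = ∃[ i ] (x i ≡ a × x (suc i) ≡ a)

Unbordered : List Bool → Set
Unbordered w = w ≢ [] × (∀ u → u ≢ [] → u ≢ w → (∃[ v ] (u ++ v ≡ w)) → (∃[ v ] (v ++ u ≡ w)) → ⊥)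

InUP : Word → ℕ → Set
InUP x n = Unbordered (pref x n)

-- UP(x) finite  (a set of prefixes, indexed by length, is finite iff bounded)
FiniteUP : Word → Set
FiniteUP x = ∃[ B ] (∀ n → InUP x n → n ≤ B)

-- N(x) = n : n is the length of the longest unbordered prefix of x
IsN : Word → ℕ → Set
IsN x n = InUP x n × (∀ m → InUP x m → m ≤ n)

-- A factorization x = U_0 U_1 ... with U_i ∈ UP(x), given by the lengths ℓ i = |U_i|.
pos : (ℕ → ℕ) → ℕ → ℕ
pos ℓ zero = 0
pos ℓ (suc i) = pos ℓ i + ℓ i

UPFactorization : Word → (ℕ → ℕ) → Set
UPFactorization x ℓ = ∀ i → fac x (pos ℓ i) (ℓ i) ≡ pref x (ℓ i) × InUP x (ℓ i)

indexOf : ℕ → List ℕ → ℕ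
indexOf n [] = 0
indexOf n (m ∷ ms) with n ≟ m
... | yes _ = 0
... | no  _ = suc (indexOf n ms)

-- φ⁻¹(U_i): rank (starting from 1) of U_i in order of first occurrence.
-- (U_i is determined by its length ℓ i since it is a prefix of x.)
code : (ℕ → ℕ) → ℕ → ℕ
code ℓ i = suc (indexOf (ℓ i) (deduplicate _≟_ (map ℓ (upTo (suc i)))))

-- d is the derived word δ(x) (a word over {1,…,n_x} ⊆ ℕ)
IsDerived : Word → (ℕ → ℕ) → Set
IsDerived x d = ∃[ ℓ ] (UPFactorization x ℓ × (∀ i → d i ≡ code ℓ i))

WordIso : Word → (ℕ → ℕ) → Set
WordIso y d = ∃[ f ] (Injective _≡_ _≡_ f × (∀ i → d i ≡ f (y i)))

_≟ᵇ'_ : Bool → Bool → Bool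
false ≟ᵇ' false = true
true  ≟ᵇ' true  = true
_     ≟ᵇ' _     = false

La : Bool → Bool → List Bool
La a c = if c ≟ᵇ' a then [ a ] else (a ∷ c ∷ [])

Ra : Bool → Bool → List Bool
Ra a c = if c ≟ᵇ' a then [ a ] else (c ∷ a ∷ [])

img : (Bool → List Bool) → List Bool → List Bool
img h = concatMap h

-- x = h(y) for infinite words (h non-erasing): every h(prefix of y) is a prefix of x
IsImage : (Bool → List Bool) → Word → Word → Set
IsImage h y x = ∀ n → img h (pref y n) ≡ pref x (length (img h (pref y n)))

UPBijection : (Bool → List Bool) → Word → Word → (List Bool → Set) → Set
UPBijection h y x E =
  (∀ n → InUP y n → ∃[ m ] (InUP x m × ¬ E (pref x m) × img h (pref y n) ≡ pref x m))
  × (∀ m → InUP x m → ¬ E (pref x m) → ∃[ n ] (InUP y n × img h (pref y n) ≡ pref x m))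
  × (∀ n n' → InUP y n → InUP y n' → img h (pref y n) ≡ img h (pref y n') → n ≡ n')

NoExclusion : List Bool → Set
NoExclusion _ = ⊥

-- A Sturmian word x of type a has no factor bb (b = not a), so it is cut into blocks a and
-- ab when it begins with a, and into blocks a and ba when it begins with b; reading one
-- letter per block gives y with x = L_a(y), resp. x = R_a(y). The word y is again Sturmian:
-- an ultimate period of y yields one of x, and factors bwb and awa of y yield factors of x
-- of equal length whose numbers of b differ by 2. A border of the image of an unbordered
-- prefix of y would begin at a block start and end at a block end, so it would come from a
-- border in y; conversely borders of y map to borders of x. Hence the morphism maps UP(y)
-- bijectively onto UP(x) (except for the prefix b in the R_a case), strictly lengthens the
-- unbordered prefixes of length at least 2 (so N decreases), and maps the factorization of y
-- into unbordered prefixes onto that of x, so that δ(x) = δ(y). If N(x) = 2 then x begins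
-- with ab, its factorization into unbordered prefixes uses only a and ab, and δ(x) is y with
-- b ↦ 1 and a ↦ 2.

module Submission where

open import Defs
open import Data.Bool using (Bool; true; false; not)
open import Data.Bool.Properties using (¬-not; not-¬; not-involutive) renaming (_≟_ to _≟B_)
open import Data.Nat
open import Data.Nat.Properties
open import Data.Nat.Tactic.RingSolver
open import Data.Nat.Induction using (<-rec)
open import Data.List using (List; []; _∷_; _++_; [_]; length; map; filter; deduplicate; upTo; applyUpTo)
open import Data.List.Properties using (length-++; ∷-injective; ++-identityʳ; map-∘; filter-accept; filter-reject; filter-idem)
open import Data.List.Membership.Propositional using (_∈_)
open import Data.List.Membership.Propositional.Properties using (∈-applyUpTo⁺)
open import Data.List.Relation.Unary.Any using (here; there)
open import Data.Product hiding (map)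
open import Data.Empty
open import Data.Sum using (_⊎_; inj₁; inj₂)
open import Relation.Nullary
open import Relation.Nullary.Decidable using (decidable-stable; _×-dec_)
open import Relation.Binary.PropositionalEquality hiding ([_])
open import Function using (_∘_)
open import Function.Definitions using (Injective)

pref-ext : ∀ (f g : Word) n → (∀ t → t < n → f t ≡ g t) → pref f n ≡ pref g n
pref-ext f g zero h = refl
pref-ext f g (suc n) h = cong₂ _∷_ (h 0 (s≤s z≤n)) (pref-ext (f ∘ suc) (g ∘ suc) n (λ t t<n → h (suc t) (s≤s t<n)))

pref-ext⁻ : ∀ (f g : Word) n → pref f n ≡ pref g n → ∀ t → t < n → f t ≡ g t
pref-ext⁻ f g (suc n) eq zero _ = proj₁ (∷-injective eq)
pref-ext⁻ f g (suc n) eq (suc t) (s≤s t<n) = pref-ext⁻ (f ∘ suc) (g ∘ suc) n (proj₂ (∷-injective eq)) t t<n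

length-pref : ∀ (f : Word) n → length (pref f n) ≡ n
length-pref f zero = refl
length-pref f (suc n) = cong suc (length-pref (f ∘ suc) n)

pref-++ : ∀ (f : Word) m n → pref f (m + n) ≡ pref f m ++ pref (λ k → f (m + k)) n
pref-++ f zero n = refl
pref-++ f (suc m) n = cong (f 0 ∷_) (pref-++ (f ∘ suc) m n)

prefix≡pref : ∀ (u v : List Bool) (x : Word) n → u ++ v ≡ pref x n → u ≡ pref x (length u)
prefix≡pref [] v x n eq = refl
prefix≡pref (c ∷ u) v x zero ()
prefix≡pref (c ∷ u) v x (suc n) eq =
  cong₂ _∷_ (proj₁ (∷-injective eq)) (prefix≡pref u v (x ∘ suc) n (proj₂ (∷-injective eq)))

suffix≡shifted-pref : ∀ (v u : List Bool) (x : Word) n → v ++ u ≡ pref x n → u ≡ pref (λ k → x (length v + k)) (n ∸ length v)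
suffix≡shifted-pref [] u x n eq = eq
suffix≡shifted-pref (c ∷ v) u x zero ()
suffix≡shifted-pref (c ∷ v) u x (suc n) eq = suffix≡shifted-pref v u (x ∘ suc) n (proj₂ (∷-injective eq))

length>0 : ∀ (u : List Bool) → u ≢ [] → 0 < length u
length>0 [] ne = ⊥-elim (ne refl)
length>0 (_ ∷ _) ne = s≤s z≤n

length≡0⇒[] : ∀ (u : List Bool) → length u ≡ 0 → u ≡ []
length≡0⇒[] [] _ = refl
length≡0⇒[] (_ ∷ _) ()

-- Borders and unbordered prefixes

Border : Word → ℕ → ℕ → Set
Border x n k = 0 < k × k < n × (∀ t → t < k → x t ≡ x (n ∸ k + t))

InUP⇒borderFree : ∀ x n → InUP x n → 0 < n × (∀ k → Border x n k → ⊥)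
InUP⇒borderFree x zero (ne , _) = ⊥-elim (ne refl)
InUP⇒borderFree x (suc n) (ne , ub) = s≤s z≤n , λ k (0<k , k<n , eqs) →
  ub (pref x k) (λ e → <⇒≢ 0<k (sym (trans (sym (length-pref x k)) (cong length e))))
     (λ e → <⇒≢ k<n (trans (sym (length-pref x k)) (trans (cong length e) (length-pref x (suc n)))))
     (pref (λ t → x (k + t)) (suc n ∸ k) , trans (sym (pref-++ x k (suc n ∸ k))) (cong (pref x) (m+[n∸m]≡n (<⇒≤ k<n))))
     (pref x (suc n ∸ k) ,
       trans (cong (pref x (suc n ∸ k) ++_) (pref-ext x (λ t → x (suc n ∸ k + t)) k eqs))
        (trans (sym (pref-++ x (suc n ∸ k) k)) (cong (pref x) (m∸n+n≡m (<⇒≤ k<n)))))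

borderFree⇒InUP : ∀ x n → 0 < n → (∀ k → Border x n k → ⊥) → InUP x n
borderFree⇒InUP x zero () _
borderFree⇒InUP x (suc n) _ nb = (λ ()) , λ u u≢[] u≢w (v , uv) (v' , v'u) → body u u≢[] u≢w v uv v' v'u
  where
  body : ∀ u → u ≢ [] → u ≢ pref x (suc n) → ∀ v → u ++ v ≡ pref x (suc n) → ∀ v' → v' ++ u ≡ pref x (suc n) → ⊥
  body u u≢[] u≢w v uv v' v'u = nb (length u) (0<k , k<n , pw)
    where
    lens : length u + length v ≡ suc n
    lens = trans (sym (length-++ u)) (trans (cong length uv) (length-pref x (suc n)))
    lens' : length v' + length u ≡ suc n
    lens' = trans (sym (length-++ v')) (trans (cong length v'u) (length-pref x (suc n)))
    0<k : 0 < length u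
    0<k = length>0 u u≢[]
    k<n : length u < suc n
    k<n with m≤n⇒m<n∨m≡n (subst (length u ≤_) lens (m≤m+n (length u) (length v)))
    ... | inj₁ lt = lt
    ... | inj₂ eq = ⊥-elim (u≢w (trans (sym (++-identityʳ u)) (trans (cong (u ++_) (sym vnil)) uv)))
      where
      vnil : v ≡ []
      vnil = length≡0⇒[] v (+-cancelˡ-≡ (length u) (length v) 0 (trans lens (trans (sym eq) (sym (+-identityʳ (length u))))))
    e1 : u ≡ pref x (length u)
    e1 = prefix≡pref u v x (suc n) uv
    lv' : length v' ≡ suc n ∸ length u
    lv' = trans (sym (m+n∸n≡m (length v') (length u))) (cong (_∸ length u) lens')
    e2 : u ≡ pref (λ t → x (suc n ∸ length u + t)) (length u)
    e2 = trans (suffix≡shifted-pref v' u x (suc n) v'u)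
           (trans (cong (λ q → pref (λ t → x (q + t)) (suc n ∸ length v')) lv')
             (cong (pref (λ t → x (suc n ∸ length u + t))) (trans (cong (suc n ∸_) lv') (m∸[m∸n]≡n (<⇒≤ k<n)))))
    pw : ∀ t → t < length u → x t ≡ x (suc n ∸ length u + t)
    pw = pref-ext⁻ x (λ t → x (suc n ∸ length u + t)) (length u) (trans (sym e1) e2)

InUP⇒last≢head : ∀ x n → InUP x (suc (suc n)) → x (suc n) ≢ x 0
InUP⇒last≢head x n u eq = proj₂ (InUP⇒borderFree x _ u) 1 (s≤s z≤n , s≤s (s≤s z≤n) , headBorder)
  where
  headBorder : ∀ t → t < 1 → x t ≡ x (suc (suc n) ∸ 1 + t)
  headBorder zero _ = trans (sym eq) (cong x (sym (+-identityʳ _)))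
  headBorder (suc t) (s≤s ())

InUP-1 : ∀ x → InUP x 1
InUP-1 x = borderFree⇒InUP x 1 (s≤s z≤n) (λ k (0<k , k<1 , _) → <-irrefl refl (≤-trans (s≤s 0<k) k<1))

LeastBelow : (ℕ → Set) → ℕ → Set
LeastBelow P m = ∃ λ k → k ≤ m × P k × (∀ t → t < k → ¬ P t)

least : {P : ℕ → Set} → (∀ n → Dec (P n)) → ∀ m → P m → LeastBelow P m
least {P} P? = <-rec (λ m → P m → LeastBelow P m) search
  where
  search : ∀ m → (∀ {t} → t < m → P t → LeastBelow P t) → P m → LeastBelow P m
  search m below pm with anyUpTo? P? m
  ... | no none = m , ≤-refl , pm , λ t t<m pt → none (t , t<m , pt)
  ... | yes (t , t<m , pt) with below t<m pt
  ...   | k , k≤t , pk , minimal = k , ≤-trans k≤t (<⇒≤ t<m) , pk , minimal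

border? : ∀ x n k → Dec (Border x n k)
border? x n k with 0 <? k | k <? n | allUpTo? (λ t → x t ≟B x (n ∸ k + t)) k
... | yes a | yes b | yes c = yes (a , b , λ t t<k → c t<k)
... | no a | _ | _ = no (λ z → a (proj₁ z))
... | _ | no b | _ = no (λ z → b (proj₁ (proj₂ z)))
... | _ | _ | no c = no (λ z → c (λ {t} t<k → proj₂ (proj₂ z) t t<k))

InUP? : ∀ x n → Dec (InUP x n)
InUP? x n with 0 <? n | anyUpTo? (border? x n) n
... | no a | _ = no (λ u → a (proj₁ (InUP⇒borderFree x n u)))
... | yes a | yes (k , _ , bk) = no (λ u → proj₂ (InUP⇒borderFree x n u) k bk)
... | yes a | no nb = yes (borderFree⇒InUP x n a (λ k bk → nb (k , proj₁ (proj₂ bk) , bk)))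

-- A border of the shortest border would be a shorter border.
shortestBorder : ∀ x n → 0 < n → ¬ InUP x n → ∃ λ k → Border x n k × InUP x k
shortestBorder x n 0<n nu with anyUpTo? (border? x n) n
... | no nb = ⊥-elim (nu (borderFree⇒InUP x n 0<n (λ k bk → nb (k , proj₁ (proj₂ bk) , bk))))
... | yes (k₀ , k₀<n , bk₀) with least (border? x n) k₀ bk₀
... | k , _ , bk@(0<k , k<n , eqk) , mn = k , bk , borderFree⇒InUP x k 0<k λ j (0<j , j<k , eqj) →
        mn j j<k (0<j , <-trans j<k k<n , λ t t<j → trans (eqj t t<j) (trans (eqk (k ∸ j + t) (inside t t<j j<k))
           (cong x (shiftBack t j<k))))
  where
  inside : ∀ t {j} → t < j → j < k → k ∸ j + t < k
  inside t {j} t<j j<k = subst (k ∸ j + t <_) (m∸n+n≡m (<⇒≤ j<k)) (+-monoʳ-< (k ∸ j) t<j)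
  shiftBack : ∀ t {j} → j < k → n ∸ k + (k ∸ j + t) ≡ n ∸ j + t
  shiftBack t {j} j<k = trans (sym (+-assoc (n ∸ k) (k ∸ j) t)) (cong (_+ t) (trans (sym (+-∸-assoc (n ∸ k) (<⇒≤ j<k)))
       (cong (_∸ j) (m∸n+n≡m (<⇒≤ k<n)))))

prefixToFirstLetter-unbordered : ∀ x t → (∀ s → s < t → x s ≢ x t) → InUP x (suc t)
prefixToFirstLetter-unbordered x t first = borderFree⇒InUP x (suc t) (s≤s z≤n) noBorder
  where
  noBorder : ∀ K → Border x (suc t) K → ⊥
  noBorder (suc K) (_ , s≤s K<t , eqs) = first K K<t (trans (eqs K ≤-refl) (cong x (m∸n+n≡m (<⇒≤ K<t))))

prefixToFirstSquare-unbordered : ∀ a x k → x 0 ≢ a → x k ≡ a → x (suc k) ≡ a →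
  (∀ s → s < k → ¬ (x s ≡ a × x (suc s) ≡ a)) → InUP x (suc (suc k))
prefixToFirstSquare-unbordered a x k x0≢a xk xk' first = borderFree⇒InUP x _ (s≤s z≤n) noBorder
  where
  noBorder : ∀ K → Border x (suc (suc k)) K → ⊥
  noBorder (suc zero) (_ , _ , eqs) = x0≢a (trans (eqs 0 (s≤s z≤n)) (trans (cong x (+-identityʳ _)) xk'))
  noBorder (suc (suc K)) (_ , s≤s (s≤s K<k) , eqs) = first K K<k (xK , xK')
    where
    end : k ∸ K + K ≡ k
    end = m∸n+n≡m (<⇒≤ K<k)
    xK : x K ≡ a
    xK = trans (eqs K (s≤s (n≤1+n K))) (trans (cong x end) xk)
    xK' : x (suc K) ≡ a
    xK' = trans (eqs (suc K) ≤-refl) (trans (cong x (trans (+-suc (k ∸ K) K) (cong suc end))) xk')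

-- Factorizations into unbordered prefixes

OccursAt : Word → ℕ → ℕ → Set
OccursAt x p m = InUP x m × (∀ t → t < m → x (p + t) ≡ x t)

occursAt? : ∀ x p m → Dec (OccursAt x p m)
occursAt? x p m with InUP? x m | allUpTo? (λ t → x (p + t) ≟B x t) m
... | yes a | yes b = yes (a , λ t t<m → b t<m)
... | no a | _ = no (λ z → a (proj₁ z))
... | _ | no b = no (λ z → b (λ {t} t<m → proj₂ z t t<m))

-- Parse x p n: x[p, n) is a concatenation of occurrences of unbordered prefixes of x.
data Parse (x : Word) : ℕ → ℕ → Set where
  done : ∀ {p n} → p ≡ n → Parse x p n
  step : ∀ {p m n} → OccursAt x p m → Parse x (p + m) n → Parse x p n

parse-snoc : ∀ {x p q m} → Parse x p q → OccursAt x q m → Parse x p (q + m)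
parse-snoc {x} {p} {q} {m} (done refl) o = step o (done refl)
parse-snoc (step o' r) o = step o' (parse-snoc r o)

-- Peel off the shortest border of the prefix: it is unbordered and also occurs at the end.
parse-fuel : ∀ x fuel n → n ≤ fuel → Parse x 0 n
parse-fuel x fuel zero _ = done refl
parse-fuel x zero (suc n) ()
parse-fuel x (suc fuel) (suc n) le with InUP? x (suc n)
... | yes u = step (u , λ t _ → refl) (done refl)
... | no nu with shortestBorder x (suc n) (s≤s z≤n) nu
... | k , (0<k , k<n , eqk) , uk =
  subst (Parse x 0) (m∸n+n≡m (<⇒≤ k<n))
    (parse-snoc (parse-fuel x fuel (suc n ∸ k) (≤-pred (≤-trans (∸-monoʳ-< 0<k (<⇒≤ k<n) ) le)))
              (uk , λ t t<k → sym (eqk t t<k)))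

parse-prefix : ∀ x n → Parse x 0 n
parse-prefix x n = parse-fuel x n n ≤-refl

parse-straddle : ∀ {x c n} → Parse x c n → ∀ q → c < q → q ≤ n → ∃ λ d → ∃ λ m → c ≤ d × d < q × q ≤ d + m × OccursAt x d m
parse-straddle (done refl) q c<q q≤n = ⊥-elim (<⇒≱ c<q q≤n)
parse-straddle {x} {c} (step {m = m} o r) q c<q q≤n with q ≤? c + m
... | yes le = c , m , ≤-refl , c<q , le , o
... | no gt with parse-straddle r q (≰⇒> gt) q≤n
... | d , m' , le , d<q , q≤ , o' = d , m' , ≤-trans (m≤m+n c m) le , d<q , q≤ , o'

-- A longer unbordered prefix occurring at p would overlap the next piece of the parse, and the
-- overlap would be a border of it.
parse-head-longest : ∀ {x p m n} → OccursAt x p m → Parse x (p + m) n → ∀ m' → OccursAt x p m' → p + m' ≤ n → m' ≤ m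
parse-head-longest {x} {p} {m} {n} (um , om) r m' (um' , om') le with m' ≤? m
... | yes h = h
... | no h with parse-straddle r (p + m') (+-monoʳ-< p (≰⇒> h)) le
... | d , m'' , pm≤d , d<q , q≤ , (_ , od) = ⊥-elim (proj₂ (InUP⇒borderFree x m' um') k (0<k , k<m' , eqs))
  where
  k : ℕ
  k = p + m' ∸ d
  p<d : p < d
  p<d = <-≤-trans (m<m+n p (proj₁ (InUP⇒borderFree x m um))) pm≤d
  0<k : 0 < k
  0<k = m<n⇒0<n∸m d<q
  dp : d ∸ p + k ≡ m'
  dp = begin
    d ∸ p + (p + m' ∸ d)              ≡⟨ cong (λ z → d ∸ p + (p + m' ∸ z)) (sym (m+[n∸m]≡n (<⇒≤ p<d))) ⟩
    d ∸ p + (p + m' ∸ (p + (d ∸ p)))  ≡⟨ cong (d ∸ p +_) ([m+n]∸[m+o]≡n∸o p m' (d ∸ p)) ⟩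
    d ∸ p + (m' ∸ (d ∸ p))            ≡⟨ m+[n∸m]≡n (subst (d ∸ p ≤_) (m+n∸m≡n p m') (∸-monoˡ-≤ p (<⇒≤ d<q))) ⟩
    m'                                ∎
    where open ≡-Reasoning
  k<m' : k < m'
  k<m' = subst (k <_) dp (m<n+m k (m<n⇒0<n∸m p<d))
  m'∸k : m' ∸ k ≡ d ∸ p
  m'∸k = trans (cong (_∸ k) (sym dp)) (m+n∸n≡m (d ∸ p) k)
  t<m'' : ∀ t → t < k → t < m''
  t<m'' t t<k = ≤-trans t<k (subst (k ≤_) (m+n∸m≡n d m'') (∸-monoˡ-≤ d q≤))
  pos-eq : ∀ t → d + t ≡ p + (d ∸ p + t)
  pos-eq t = trans (cong (_+ t) (sym (m+[n∸m]≡n (<⇒≤ p<d)))) (+-assoc p (d ∸ p) t)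
  eqs : ∀ t → t < k → x t ≡ x (m' ∸ k + t)
  eqs t t<k = trans (sym (od t (t<m'' t t<k)))
              (trans (cong x (pos-eq t))
                (trans (om' (d ∸ p + t) (subst (d ∸ p + t <_) dp (+-monoʳ-< (d ∸ p) t<k)))
                  (cong (λ z → x (z + t)) (sym m'∸k))))

-- Since the head of every parse is the longest unbordered prefix occurring there, the greedy cuts
-- coincide with those of the parse of any long enough prefix.
module GreedyFactorization (x : Word) (B : ℕ) (bnd : ∀ n → InUP x n → n ≤ B) where
  longestAt : ℕ → ℕ → ℕ
  longestAt p zero = 0
  longestAt p (suc k) with occursAt? x p (suc k)
  ... | yes _ = suc k
  ... | no _ = longestAt p k

  longestAt-occurs : ∀ p k → 0 < longestAt p k → OccursAt x p (longestAt p k)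
  longestAt-occurs p zero ()
  longestAt-occurs p (suc k) lt with occursAt? x p (suc k)
  ... | yes o = o
  ... | no _ = longestAt-occurs p k lt

  longestAt-maximal : ∀ p k m → m ≤ k → OccursAt x p m → m ≤ longestAt p k
  longestAt-maximal p zero m m≤ o = m≤
  longestAt-maximal p (suc k) m m≤ o with occursAt? x p (suc k)
  ... | yes _ = m≤
  ... | no no' with m ≟ suc k
  ... | yes refl = ⊥-elim (no' o)
  ... | no ne = longestAt-maximal p k m (≤-pred (≤∧≢⇒< m≤ ne)) o

  longestAt≤ : ∀ p k → longestAt p k ≤ k
  longestAt≤ p zero = z≤n
  longestAt≤ p (suc k) with occursAt? x p (suc k)
  ... | yes _ = ≤-refl
  ... | no _ = m≤n⇒m≤1+n (longestAt≤ p k)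

  cut : ℕ → ℕ
  cut zero = 0
  cut (suc i) = cut i + longestAt (cut i) B

  cut-mono : ∀ i j → i ≤ j → cut i ≤ cut j
  cut-mono i zero z≤n = ≤-refl
  cut-mono i (suc j) le with i ≟ suc j
  ... | yes refl = ≤-refl
  ... | no ne = ≤-trans (cut-mono i j (≤-pred (≤∧≢⇒< le ne))) (m≤m+n (cut j) _)

  0<B : 0 < B
  0<B = bnd 1 (InUP-1 x)

  parse-step : ∀ n j → cut j + B ≤ n → Parse x (cut j) n → OccursAt x (cut j) (longestAt (cut j) B) × Parse x (cut (suc j)) n
  parse-step n j le (done eq) = ⊥-elim (<⇒≱ (<-≤-trans (m<m+n (cut j) 0<B) le) (≤-reflexive (sym eq)))
  parse-step n j le (step {m = m} o r) = subst (OccursAt x (cut j)) (sym bm) o , subst (λ z → Parse x (cut j + z) n) (sym bm) r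
    where
    m≤b : m ≤ longestAt (cut j) B
    m≤b = longestAt-maximal (cut j) B m (bnd m (proj₁ o)) o
    ob : OccursAt x (cut j) (longestAt (cut j) B)
    ob = longestAt-occurs (cut j) B (<-≤-trans (proj₁ (InUP⇒borderFree x m (proj₁ o))) m≤b)
    b≤m : longestAt (cut j) B ≤ m
    b≤m = parse-head-longest o r (longestAt (cut j) B) ob (≤-trans (+-monoʳ-≤ (cut j) (longestAt≤ (cut j) B)) le)
    bm : longestAt (cut j) B ≡ m
    bm = ≤-antisym b≤m m≤b

  parse-from-cut : ∀ i j → j ≤ i → Parse x (cut j) (cut i + B)
  parse-from-cut i zero _ = parse-prefix x (cut i + B)
  parse-from-cut i (suc j) le = proj₂ (parse-step (cut i + B) j (+-monoˡ-≤ B (cut-mono j i (≤-trans (n≤1+n j) le))) (parse-from-cut i j (≤-trans (n≤1+n j) le)))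

  occurs-at-cut : ∀ i → OccursAt x (cut i) (longestAt (cut i) B)
  occurs-at-cut i = proj₁ (parse-step (cut i + B) i ≤-refl (parse-from-cut i i ≤-refl))

  ℓ : ℕ → ℕ
  ℓ i = longestAt (cut i) B

  pos≡cut : ∀ i → pos ℓ i ≡ cut i
  pos≡cut zero = refl
  pos≡cut (suc i) = cong (_+ ℓ i) (pos≡cut i)

  factorization : UPFactorization x ℓ
  factorization i = subst (λ z → fac x z (ℓ i) ≡ pref x (ℓ i)) (sym (pos≡cut i))
                      (pref-ext (λ k → x (cut i + k)) x (ℓ i) (proj₂ (occurs-at-cut i))) , proj₁ (occurs-at-cut i)

UPFactorization-exists : ∀ x → FiniteUP x → ∃ λ ℓ → UPFactorization x ℓ
UPFactorization-exists x (B , bnd) = GreedyFactorization.ℓ x B bnd , GreedyFactorization.factorization x B bnd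

-- Codes of derived words

filter-map : ∀ (f : ℕ → ℕ) → Injective _≡_ _≡_ f → ∀ c L →
   filter (¬? ∘ (f c ≟_)) (map f L) ≡ map f (filter (¬? ∘ (c ≟_)) L)
filter-map f inj c [] = refl
filter-map f inj c (d ∷ L) with f c ≟ f d | c ≟ d
... | yes p | yes q = trans (filter-reject (¬? ∘ (f c ≟_)) (λ np → np p))
      (trans (filter-map f inj c L) (cong (map f) (sym (filter-reject (¬? ∘ (c ≟_)) (λ nq → nq q)))))
... | yes p | no q = ⊥-elim (q (inj p))
... | no p | yes refl = ⊥-elim (p refl)
... | no p | no q = trans (filter-accept (¬? ∘ (f c ≟_)) p)
      (trans (cong (f d ∷_) (filter-map f inj c L)) (cong (map f) (sym (filter-accept (¬? ∘ (c ≟_)) q))))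

deduplicate-map : ∀ (f : ℕ → ℕ) → Injective _≡_ _≡_ f → ∀ L →
   deduplicate _≟_ (map f L) ≡ map f (deduplicate _≟_ L)
deduplicate-map f inj [] = refl
deduplicate-map f inj (c ∷ L) = cong (f c ∷_) (trans (cong (filter (¬? ∘ (f c ≟_))) (deduplicate-map f inj L)) (filter-map f inj c (deduplicate _≟_ L)))

indexOf-map : ∀ (f : ℕ → ℕ) → Injective _≡_ _≡_ f → ∀ n L → indexOf (f n) (map f L) ≡ indexOf n L
indexOf-map f inj n [] = refl
indexOf-map f inj n (m ∷ L) with f n ≟ f m | n ≟ m
... | yes p | yes q = refl
... | yes p | no q = ⊥-elim (q (inj p))
... | no p | yes refl = ⊥-elim (p refl)
... | no p | no q = cong suc (indexOf-map f inj n L)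

code-∘-injective : ∀ (f : ℕ → ℕ) → Injective _≡_ _≡_ f → ∀ ℓ i → code (f ∘ ℓ) i ≡ code ℓ i
code-∘-injective f inj ℓ i = cong suc (trans (cong (λ z → indexOf (f (ℓ i)) (deduplicate _≟_ z)) (map-∘ (upTo (suc i))))
   (trans (cong (indexOf (f (ℓ i))) (deduplicate-map f inj (map ℓ (upTo (suc i))))) (indexOf-map f inj (ℓ i) _)))

indexOf-head : ∀ n m L → n ≡ m → indexOf n (m ∷ L) ≡ 0
indexOf-head n m L e with n ≟ m
... | yes _ = refl
... | no ne = ⊥-elim (ne e)

indexOf-tail : ∀ n m L → n ≢ m → indexOf n (m ∷ L) ≡ suc (indexOf n L)
indexOf-tail n m L ne with n ≟ m
... | yes e = ⊥-elim (ne e)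
... | no _ = refl

without2-startsWith-1 : ∀ (ℓ : ℕ → ℕ) → (∀ t → ℓ t ≡ 1 ⊎ ℓ t ≡ 2) → ∀ L t → t ∈ L → ℓ t ≡ 1 →
  ∃ λ M → filter (¬? ∘ (2 ≟_)) (deduplicate _≟_ (map ℓ L)) ≡ 1 ∷ M
without2-startsWith-1 ℓ vals (c ∷ L) t t∈ ℓt≡1 with vals c | t∈
... | inj₁ ℓc≡1 | _ rewrite ℓc≡1 = _ , refl
... | inj₂ ℓc≡2 | here refl = contradiction (trans (sym ℓt≡1) ℓc≡2) λ ()
... | inj₂ ℓc≡2 | there t∈L rewrite ℓc≡2 | filter-idem (¬? ∘ (2 ≟_)) (deduplicate _≟_ (map ℓ L)) =
  without2-startsWith-1 ℓ vals L t t∈L ℓt≡1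

code-of-lengths-1-2 : ∀ (ℓ : ℕ → ℕ) → (∀ t → ℓ t ≡ 1 ⊎ ℓ t ≡ 2) → ℓ 0 ≡ 2 → ∀ i → code ℓ i ≡ 3 ∸ ℓ i
code-of-lengths-1-2 ℓ vals ℓ0 i with vals i
code-of-lengths-1-2 ℓ vals ℓ0 i | inj₂ ℓi≡2 =
  trans (cong suc (indexOf-head (ℓ i) (ℓ 0) _ (trans ℓi≡2 (sym ℓ0)))) (cong (3 ∸_) (sym ℓi≡2))
code-of-lengths-1-2 ℓ vals ℓ0 zero | inj₁ ℓ0≡1 = contradiction (trans (sym ℓ0≡1) ℓ0) λ ()
code-of-lengths-1-2 ℓ vals ℓ0 (suc i) | inj₁ ℓi≡1 =
  trans (cong suc (trans (indexOf-tail (ℓ (suc i)) (ℓ 0) _ ℓi≢ℓ0) (cong suc later))) (cong (3 ∸_) (sym ℓi≡1))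
  where
  ℓi≢ℓ0 : ℓ (suc i) ≢ ℓ 0
  ℓi≢ℓ0 e = contradiction (trans (sym ℓi≡1) (trans e ℓ0)) λ ()
  later : indexOf (ℓ (suc i)) (filter (¬? ∘ (ℓ 0 ≟_)) (deduplicate _≟_ (map ℓ (applyUpTo suc (suc i))))) ≡ 0
  later with without2-startsWith-1 ℓ vals (applyUpTo suc (suc i)) (suc i) (∈-applyUpTo⁺ suc ≤-refl) ℓi≡1
  ... | M , eq rewrite ℓ0 | eq = indexOf-head (ℓ (suc i)) 1 M ℓi≡1

ind : Bool → Bool → ℕ
ind false false = 1
ind true true = 1
ind false true = 0
ind true false = 0

count-cons : ∀ c d w → count c (d ∷ w) ≡ ind c d + count c w
count-cons false false w = refl
count-cons false true w = refl
count-cons true false w = refl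
count-cons true true w = refl

≢not⇒≡ : ∀ {u a : Bool} → u ≢ not a → u ≡ a
≢not⇒≡ {u} {a} ne = trans (¬-not ne) (not-involutive a)

ind-hit : ∀ {c d} → d ≡ c → ind c d ≡ 1
ind-hit {false} refl = refl
ind-hit {true} refl = refl

ind-miss : ∀ {a d} → d ≡ a → ind (not a) d ≡ 0
ind-miss {false} refl = refl
ind-miss {true} refl = refl

ind≤1 : ∀ c d → ind c d ≤ 1
ind≤1 false false = ≤-refl
ind≤1 false true = z≤n
ind≤1 true false = z≤n
ind≤1 true true = ≤-refl

ind+ind-not : ∀ c d → ind c d + ind (not c) d ≡ 1
ind+ind-not false false = refl
ind+ind-not false true = refl
ind+ind-not true false = refl
ind+ind-not true true = refl

ind-distinct : ∀ a c c' → c ≢ c' → 1 ≤ ind (not a) c + ind (not a) c'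
ind-distinct false false false ne = ⊥-elim (ne refl)
ind-distinct false false true ne = ≤-refl
ind-distinct false true false ne = ≤-refl
ind-distinct false true true ne = ⊥-elim (ne refl)
ind-distinct true false false ne = ⊥-elim (ne refl)
ind-distinct true false true ne = ≤-refl
ind-distinct true true false ne = ≤-refl
ind-distinct true true true ne = ⊥-elim (ne refl)

count-++ : ∀ c u v → count c (u ++ v) ≡ count c u + count c v
count-++ c [] v = refl
count-++ c (d ∷ u) v = trans (count-cons c d (u ++ v)) (trans (cong (ind c d +_) (count-++ c u v))
   (trans (sym (+-assoc (ind c d) _ _)) (cong (_+ count c v) (sym (count-cons c d u)))))

count-≤ : ∀ c w → count c w ≤ length w
count-≤ c [] = z≤n
count-≤ c (d ∷ w) = subst (_≤ suc (length w)) (sym (count-cons c d w)) (+-mono-≤ (ind≤1 c d) (count-≤ c w))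

count+count-not : ∀ c w → count c w + count (not c) w ≡ length w
count+count-not c [] = refl
count+count-not c (d ∷ w) = trans (cong₂ _+_ (count-cons c d w) (count-cons (not c) d w))
  (trans (lem (ind c d) (count c w) (ind (not c) d) (count (not c) w))
    (cong₂ _+_ (ind+ind-not c d) (count+count-not c w)))
  where
  lem : ∀ p q r s → (p + q) + (r + s) ≡ (p + r) + (q + s)
  lem = solve-∀

fac-ext : ∀ (y z : Word) i j n → (∀ t → t < n → y (i + t) ≡ z (j + t)) → fac y i n ≡ fac z j n
fac-ext y z i j n h = pref-ext (λ k → y (i + k)) (λ k → z (j + k)) n h

fac-ext⁻ : ∀ (y z : Word) i j n → fac y i n ≡ fac z j n → ∀ t → t < n → y (i + t) ≡ z (j + t)
fac-ext⁻ y z i j n e = pref-ext⁻ (λ k → y (i + k)) (λ k → z (j + k)) n e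

fac-suc : ∀ (y : Word) i n → fac y i (suc n) ≡ y i ∷ fac y (suc i) n
fac-suc y i n = cong₂ _∷_ (cong y (+-identityʳ i)) (pref-ext _ _ n (λ t _ → cong y (+-suc i t)))

fac-+ : ∀ (y : Word) i m n → fac y i (m + n) ≡ fac y i m ++ fac y (i + m) n
fac-+ y i m n = trans (pref-++ (λ k → y (i + k)) m n) (cong (fac y i m ++_) (pref-ext _ _ n (λ t _ → cong y (sym (+-assoc i m t)))))

fac1 : ∀ (x : Word) p → fac x p 1 ≡ x p ∷ []
fac1 x p = cong (_∷ []) (cong x (+-identityʳ p))

fac2 : ∀ (x : Word) p → fac x p 2 ≡ x p ∷ x (suc p) ∷ []
fac2 x p = cong₂ _∷_ (cong x (+-identityʳ p)) (cong (_∷ []) (cong x (+-comm p 1)))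

cnt : Bool → Word → ℕ → ℕ → ℕ
cnt c y i n = count c (fac y i n)

cnt-suc-left : ∀ c y i n → cnt c y i (suc n) ≡ ind c (y i) + cnt c y (suc i) n
cnt-suc-left c y i n = trans (cong (count c) (fac-suc y i n)) (count-cons c (y i) _)

cnt-+ : ∀ c y i m n → cnt c y i (m + n) ≡ cnt c y i m + cnt c y (i + m) n
cnt-+ c y i m n = trans (cong (count c) (fac-+ y i m n)) (count-++ c (fac y i m) (fac y (i + m) n))

cnt-suc-right : ∀ c y i n → cnt c y i (suc n) ≡ cnt c y i n + ind c (y (i + n))
cnt-suc-right c y i n = trans (cong (cnt c y i) (+-comm 1 n)) (trans (cnt-+ c y i n 1)
   (cong (cnt c y i n +_) (trans (cnt-suc-left c y (i + n) 0) (+-identityʳ _))))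

cnt≤ : ∀ c y i n → cnt c y i n ≤ n
cnt≤ c y i n = subst (cnt c y i n ≤_) (length-pref _ n) (count-≤ c (fac y i n))

cnt-2 : ∀ c (x : Word) p → cnt c x p 2 ≡ ind c (x p) + ind c (x (suc p))
cnt-2 c x p = trans (cong (count c) (fac2 x p)) (trans (count-cons c (x p) _) (cong (ind c (x p) +_) (trans (count-cons c _ []) (+-identityʳ _))))

-- Balance

gap-drop-left : ∀ p q r s → p ≤ q → 2 + (q + r) ≤ p + s → 2 + r ≤ s
gap-drop-left p q r s p≤q h = +-cancelˡ-≤ q (2 + r) s (≤-trans (≤-reflexive (e q r)) (≤-trans h (+-monoˡ-≤ s p≤q)))
  where
  e : ∀ q r → q + (2 + r) ≡ 2 + (q + r)
  e = solve-∀

gap-drop-right : ∀ p q r s → p ≤ q → 2 + (r + q) ≤ s + p → 2 + r ≤ s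
gap-drop-right p q r s p≤q h = gap-drop-left p q r s p≤q (subst₂ (λ u v → 2 + u ≤ v) (+-comm r q) (+-comm s p) h)

2≰1 : 2 ≤ 1 → ⊥
2≰1 (s≤s ())

∣2+c-c∣≰1 : ∀ c → ∣ suc (suc c) - c ∣ ≤ 1 → ⊥
∣2+c-c∣≰1 zero h = 2≰1 h
∣2+c-c∣≰1 (suc c) h = ∣2+c-c∣≰1 c h

∣-∣≰1⇒gap : ∀ p q → ¬ (∣ p - q ∣ ≤ 1) → 2 + q ≤ p ⊎ 2 + p ≤ q
∣-∣≰1⇒gap p q nle with ≤-total p q
... | inj₁ p≤q = inj₂ (subst (2 + p ≤_) (m∸n+n≡m p≤q) (+-monoˡ-≤ p (≰⇒> (subst (λ z → ¬ z ≤ 1) (m≤n⇒∣m-n∣≡n∸m p≤q) nle))))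
... | inj₂ q≤p = inj₁ (subst (2 + q ≤_) (m∸n+n≡m q≤p) (+-monoˡ-≤ q (≰⇒> (subst (λ z → ¬ z ≤ 1) (m≤n⇒∣n-m∣≡n∸m q≤p) nle))))

gap-complement : ∀ p p' q q' n → p + p' ≡ n → q + q' ≡ n → 2 + q ≤ p → 2 + p' ≤ q'
gap-complement p p' q q' n e1 e2 h = +-cancelˡ-≤ q (2 + p') q' (≤-trans (≤-reflexive (r1 q p')) (≤-trans (+-monoˡ-≤ p' h) (≤-reflexive (trans e1 (sym e2)))))
  where
  r1 : ∀ q p' → q + (2 + p') ≡ 2 + q + p'
  r1 = solve-∀

-- Two factors of equal length whose numbers of b differ by 2 can be shortened at both ends until
-- they become b w b and a w a; the search for the first mismatch handles the case where the
-- inner parts are balanced but different.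
module UnbalancedFactor (a : Bool) (y : Word) where
  b : Bool
  b = not a

  cntb : ℕ → ℕ → ℕ
  cntb = cnt b y

  MinimalUnbalancedPair : Set
  MinimalUnbalancedPair = ∃ λ i → ∃ λ j → ∃ λ m → y i ≡ b × y (suc (i + m)) ≡ b × y j ≡ a × y (suc (j + m)) ≡ a
              × (∀ t → t < m → y (suc (i + t)) ≡ y (suc (j + t)))

  ind-b≤-unless-ba : ∀ i j → ¬ (y i ≡ b × y j ≡ a) → ind b (y i) ≤ ind b (y j)
  ind-b≤-unless-ba i j ng with y i ≟B b | y j ≟B a
  ... | yes p | yes q = ⊥-elim (ng (p , q))
  ... | no p | _ = subst (_≤ ind b (y j)) (sym (ind-miss (≢not⇒≡ p))) z≤n
  ... | yes p | no q = subst (ind b (y i) ≤_) (sym (ind-hit (¬-not q))) (ind≤1 b (y i))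

  <⇒+suc≡ : ∀ {t m} → t < m → ∃ λ r → t + suc r ≡ m
  <⇒+suc≡ {t} {m} t<m = m ∸ suc t , trans (+-suc t (m ∸ suc t)) (m+[n∸m]≡n t<m)

  -- For factors b u b at i and a v a at j with |u|_b = |v|_b: either u = v, or at the first difference
  -- u has b (a shorter pair) or a, and then the remaining suffixes differ by 2 in their number of b.
  equalInner⇒pair : ∀ {F} → (∀ n i j → n ≤ F → 2 + cntb j n ≤ cntb i n → MinimalUnbalancedPair) →
    ∀ i j m → m ≤ F → y i ≡ b → y (i + suc m) ≡ b → y j ≡ a → y (j + suc m) ≡ a →
    cntb (suc i) m ≡ cntb (suc j) m → MinimalUnbalancedPair
  equalInner⇒pair rec i j m m≤F yi yi' yj yj' sameCount with allUpTo? (λ t → y (suc i + t) ≟B y (suc j + t)) m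
  ... | yes all = i , j , m , yi , trans (cong y (sym (+-suc i m))) yi' , yj , trans (cong y (sym (+-suc j m))) yj' , λ t t<m → all t<m
  ... | no nall with anyUpTo? (λ t → ¬? (y (suc i + t) ≟B y (suc j + t))) m
  ... | no nany = ⊥-elim (nall (λ {t} t<m → decidable-stable (y (suc i + t) ≟B y (suc j + t)) (λ ne → nany (t , t<m , ne))))
  ... | yes (t₀ , t₀<m , ne₀) with least (λ t → ¬? (y (suc i + t) ≟B y (suc j + t))) t₀ ne₀
  ... | t , t≤t₀ , ne , before with y (suc i + t) ≟B b
  ... | yes yb = i , j , t , yi , yb , yj , ≢not⇒≡ (λ e → ne (trans yb (sym e))) ,
                 λ t' t'<t → decidable-stable (y (suc i + t') ≟B y (suc j + t')) (before t' t'<t)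
  ... | no ya with <⇒+suc≡ (≤-<-trans t≤t₀ t₀<m)
  ... | r , em = rec (suc r) i' j' (≤-trans (m≤n+m (suc r) t) (≤-trans (≤-reflexive em) m≤F)) gap
    where
    yia : y (suc i + t) ≡ a
    yia = ≢not⇒≡ ya
    yjb : y (suc j + t) ≡ b
    yjb = ¬-not (λ e → ne (trans yia (sym e)))
    i' j' P Ru Rv : ℕ
    i' = suc (suc i + t)
    j' = suc (suc j + t)
    P = cntb (suc i) t
    Ru = cntb i' r
    Rv = cntb j' r
    Peq : P ≡ cntb (suc j) t
    Peq = cong (count b) (fac-ext y y (suc i) (suc j) t (λ t' t'<t → decidable-stable (y (suc i + t') ≟B y (suc j + t')) (before t' t'<t)))
    cuE : cntb (suc i) m ≡ P + Ru
    cuE = trans (cong (cntb (suc i)) (sym em)) (trans (cnt-+ b y (suc i) t (suc r))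
            (cong (P +_) (trans (cnt-suc-left b y (suc i + t) r) (cong (_+ Ru) (ind-miss yia)))))
    cvE : cntb (suc j) m ≡ P + suc Rv
    cvE = trans (cong (cntb (suc j)) (sym em)) (trans (cnt-+ b y (suc j) t (suc r))
            (cong₂ _+_ (sym Peq) (trans (cnt-suc-left b y (suc j + t) r) (cong (_+ Rv) (ind-hit yjb)))))
    RuE : Ru ≡ suc Rv
    RuE = +-cancelˡ-≡ P Ru (suc Rv) (trans (sym cuE) (trans sameCount cvE))
    ar : ∀ i t r → suc (suc i + t) + r ≡ i + suc (t + suc r)
    ar = solve-∀
    yend : y (i' + r) ≡ b
    yend = trans (cong y (trans (ar i t r) (cong (λ z → i + suc z) em))) yi'
    jend : y (j' + r) ≡ a
    jend = trans (cong y (trans (ar j t r) (cong (λ z → j + suc z) em))) yj'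
    gap : 2 + cntb j' (suc r) ≤ cntb i' (suc r)
    gap = subst₂ (λ u v → 2 + u ≤ v)
            (sym (trans (cnt-suc-right b y j' r) (trans (cong (Rv +_) (ind-miss jend)) (+-identityʳ Rv))))
            (sym (trans (cnt-suc-right b y i' r) (trans (cong₂ _+_ RuE (ind-hit yend)) (+-comm (suc Rv) 1))))
            ≤-refl

  minimalUnbalancedPair : ∀ fuel n i j → n ≤ fuel → 2 + cntb j n ≤ cntb i n → MinimalUnbalancedPair
  minimalUnbalancedPair fuel zero i j le ()
  minimalUnbalancedPair zero (suc n) i j () h
  minimalUnbalancedPair (suc fuel) (suc n) i j le h with y i ≟B b | y j ≟B a
  ... | no p | _ = minimalUnbalancedPair fuel n (suc i) (suc j) (≤-pred le)
        (gap-drop-left _ _ _ _ (ind-b≤-unless-ba i j (λ z → p (proj₁ z))) (subst₂ (λ u v → 2 + u ≤ v) (cnt-suc-left b y j n) (cnt-suc-left b y i n) h))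
  ... | yes p | no q = minimalUnbalancedPair fuel n (suc i) (suc j) (≤-pred le)
        (gap-drop-left _ _ _ _ (ind-b≤-unless-ba i j (λ z → q (proj₂ z))) (subst₂ (λ u v → 2 + u ≤ v) (cnt-suc-left b y j n) (cnt-suc-left b y i n) h))
  ... | yes p | yes q with y (i + n) ≟B b | y (j + n) ≟B a
  ... | no p' | _ = minimalUnbalancedPair fuel n i j (≤-pred le)
        (gap-drop-right _ _ _ _ (ind-b≤-unless-ba (i + n) (j + n) (λ z → p' (proj₁ z))) (subst₂ (λ u v → 2 + u ≤ v) (cnt-suc-right b y j n) (cnt-suc-right b y i n) h))
  ... | yes p' | no q' = minimalUnbalancedPair fuel n i j (≤-pred le)
        (gap-drop-right _ _ _ _ (ind-b≤-unless-ba (i + n) (j + n) (λ z → q' (proj₂ z))) (subst₂ (λ u v → 2 + u ≤ v) (cnt-suc-right b y j n) (cnt-suc-right b y i n) h))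
  minimalUnbalancedPair (suc fuel) (suc zero) i j le h | yes p | yes q | yes p' | yes q' =
        ⊥-elim (2≰1 (≤-trans (≤-trans (m≤m+n 2 _) h) (cnt≤ b y i 1)))
  minimalUnbalancedPair (suc fuel) (suc (suc m)) i j le h | yes p | yes q | yes p' | yes q' = compareInner
    where
    cu cv : ℕ
    cu = cntb (suc i) m
    cv = cntb (suc j) m
    eI1 : cntb i (suc m) ≡ 1 + cu
    eI1 = trans (cnt-suc-left b y i m) (cong (_+ cu) (ind-hit p))
    eJ1 : cntb j (suc m) ≡ cv
    eJ1 = trans (cnt-suc-left b y j m) (cong (_+ cv) (ind-miss q))
    eI : cntb i (suc (suc m)) ≡ 2 + cu
    eI = trans (cnt-suc-right b y i (suc m)) (trans (cong₂ _+_ eI1 (ind-hit p')) (+-comm (1 + cu) 1))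
    eJ : cntb j (suc (suc m)) ≡ cv
    eJ = trans (cnt-suc-right b y j (suc m)) (trans (cong₂ _+_ eJ1 (ind-miss q')) (+-identityʳ cv))
    cv≤cu : cv ≤ cu
    cv≤cu = +-cancelˡ-≤ 2 cv cu (subst₂ (λ u v → 2 + u ≤ v) eJ eI h)
    compareInner : MinimalUnbalancedPair
    compareInner with suc cv ≤? cu
    ... | yes lt = minimalUnbalancedPair fuel (suc m) i j (≤-pred le)
           (subst₂ (λ u v → 2 + u ≤ v) (sym eJ1) (sym eI1) (s≤s lt))
    ... | no nlt = equalInner⇒pair (minimalUnbalancedPair fuel) i j m (≤-trans (n≤1+n m) (≤-pred le)) p p' q q'
                     (sym (≤-antisym cv≤cu (≮⇒≥ nlt)))

  a+b≡length : ∀ i n → cnt a y i n + cntb i n ≡ n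
  a+b≡length i n = trans (count+count-not a (fac y i n)) (length-pref _ n)

  b-unbalanced⇒pair : ∀ i j n → ¬ (∣ cntb i n - cntb j n ∣ ≤ 1) → MinimalUnbalancedPair
  b-unbalanced⇒pair i j n nok with ∣-∣≰1⇒gap _ _ nok
  ... | inj₁ gap = minimalUnbalancedPair n n i j ≤-refl gap
  ... | inj₂ gap = minimalUnbalancedPair n n j i ≤-refl gap

  unbalanced⇒pair : ∀ c i j n → ¬ (∣ cnt c y i n - cnt c y j n ∣ ≤ 1) → MinimalUnbalancedPair
  unbalanced⇒pair c i j n nok with c ≟B a
  ... | no c≢a = b-unbalanced⇒pair i j n (subst (λ z → ¬ (∣ cnt z y i n - cnt z y j n ∣ ≤ 1)) (¬-not c≢a) nok)
  ... | yes refl with ∣-∣≰1⇒gap _ _ nok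
  ...   | inj₁ gap = minimalUnbalancedPair n n j i ≤-refl (gap-complement _ _ _ _ n (a+b≡length i n) (a+b≡length j n) gap)
  ...   | inj₂ gap = minimalUnbalancedPair n n i j ≤-refl (gap-complement _ _ _ _ n (a+b≡length j n) (a+b≡length i n) gap)

  noPair⇒balanced : ¬ MinimalUnbalancedPair → Balanced y
  noPair⇒balanced noPair c i j n with ∣ cnt c y i n - cnt c y j n ∣ ≤? 1
  ... | yes ok = ok
  ... | no nok = ⊥-elim (noPair (unbalanced⇒pair c i j n nok))

NoSquareOf : Bool → Word → Set
NoSquareOf c x = ∀ i → x i ≡ c → x (suc i) ≡ c → ⊥

noSquareOfOther : ∀ a x → Balanced x → ContainsSquareOf a x → NoSquareOf (not a) x
noSquareOfOther a x balanced (k , xk , xk') i xi xi' =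
  ∣2+c-c∣≰1 0 (subst₂ (λ u v → ∣ u - v ∣ ≤ 1) bb aa (balanced (not a) i k 2))
  where
  bb : cnt (not a) x i 2 ≡ 2
  bb = trans (cnt-2 (not a) x i) (cong₂ _+_ (ind-hit xi) (ind-hit xi'))
  aa : cnt (not a) x k 2 ≡ 0
  aa = trans (cnt-2 (not a) x k) (cong₂ _+_ (ind-miss xk) (ind-miss xk'))

-- x is the concatenation of the blocks h (y i), block i starting at position s i.
module Desubstitution (a : Bool) (h : Bool → List Bool) (h-a : h a ≡ [ a ]) (length-h-b : length (h (not a)) ≡ 2)
            (count-h-b : count (not a) (h (not a)) ≡ 1)
            (x y : Word) (s : ℕ → ℕ) (s-zero : s 0 ≡ 0) (s-suc : ∀ i → s (suc i) ≡ s i + length (h (y i)))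
            (blockAt : ∀ i → fac x (s i) (length (h (y i))) ≡ h (y i)) where
  b : Bool
  b = not a

  length-h : ∀ c → length (h c) ≡ suc (ind b c)
  length-h c with c ≟B a
  ... | yes refl = trans (cong length h-a) (cong suc (sym (ind-miss refl)))
  ... | no ne = trans (cong (length ∘ h) (¬-not ne)) (trans length-h-b (cong suc (sym (ind-hit (¬-not ne)))))

  count-h : ∀ c → count b (h c) ≡ ind b c
  count-h c with c ≟B a
  ... | yes refl = trans (cong (count b) h-a) (trans (count-cons b a []) (+-identityʳ _))
  ... | no ne = trans (cong (count b ∘ h) (¬-not ne)) (trans count-h-b (sym (ind-hit (¬-not ne))))

  length-img : ∀ w → length (img h w) ≡ length w + count b w
  length-img [] = refl
  length-img (c ∷ w) = trans (length-++ (h c)) (trans (cong₂ _+_ (length-h c) (length-img w))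
     (trans (r (ind b c) (length w) (count b w)) (cong (suc (length w) +_) (sym (count-cons b c w)))))
    where
    r : ∀ p q r → suc p + (q + r) ≡ suc q + (p + r)
    r = solve-∀

  count-img : ∀ w → count b (img h w) ≡ count b w
  count-img [] = refl
  count-img (c ∷ w) = trans (count-++ b (h c) (img h w)) (trans (cong₂ _+_ (count-h c) (count-img w)) (sym (count-cons b c w)))

  imgLength : ℕ → ℕ → ℕ
  imgLength i n = length (img h (fac y i n))

  imgLength≡ : ∀ i n → imgLength i n ≡ n + cnt b y i n
  imgLength≡ i n = trans (length-img (fac y i n)) (cong (_+ cnt b y i n) (length-pref _ n))

  img-fac : ∀ n i → img h (fac y i n) ≡ fac x (s i) (imgLength i n) × s (i + n) ≡ s i + imgLength i n
  img-fac zero i = refl , trans (cong s (+-identityʳ i)) (sym (+-identityʳ _))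
  img-fac (suc n) i = e-img , e-s
    where
    e1 : fac y i (suc n) ≡ y i ∷ fac y (suc i) n
    e1 = fac-suc y i n
    L1 L2 : ℕ
    L1 = length (h (y i))
    L2 = imgLength (suc i) n
    IH : img h (fac y (suc i) n) ≡ fac x (s (suc i)) L2 × s (suc i + n) ≡ s (suc i) + L2
    IH = img-fac n (suc i)
    elen : imgLength i (suc n) ≡ L1 + L2
    elen = trans (cong (length ∘ img h) e1) (length-++ (h (y i)))
    e-img : img h (fac y i (suc n)) ≡ fac x (s i) (imgLength i (suc n))
    e-img = trans (cong (img h) e1) (trans (cong₂ _++_ (sym (blockAt i)) (trans (proj₁ IH) (cong (λ z → fac x z L2) (s-suc i))))
              (trans (sym (fac-+ x (s i) L1 L2)) (cong (fac x (s i)) (sym elen))))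
    e-s : s (i + suc n) ≡ s i + imgLength i (suc n)
    e-s = trans (cong s (+-suc i n)) (trans (proj₂ IH) (trans (cong (_+ L2) (s-suc i)) (trans (+-assoc (s i) L1 L2) (cong (s i +_) (sym elen)))))

  isImage : IsImage h y x
  isImage n = trans (proj₁ (img-fac n 0)) (cong (λ z → fac x z (imgLength 0 n)) s-zero)

  s≡imgLength : ∀ n → s n ≡ imgLength 0 n
  s≡imgLength n = trans (proj₂ (img-fac n 0)) (cong (_+ imgLength 0 n) s-zero)

  s-<-suc : ∀ i → s i < s (suc i)
  s-<-suc i = subst (s i <_) (sym (s-suc i)) (subst (λ z → s i < s i + z) (sym (length-h (y i))) (m<m+n (s i) (s≤s z≤n)))

  s-strictMono : ∀ i j → i < j → s i < s j
  s-strictMono i (suc j) (s≤s i≤j) with i ≟ j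
  ... | yes refl = s-<-suc i
  ... | no ne = <-trans (s-strictMono i j (≤∧≢⇒< i≤j ne)) (s-<-suc j)

  s-monotone : ∀ {i j} → i ≤ j → s i ≤ s j
  s-monotone {i} {j} i≤j with i ≟ j
  ... | yes refl = ≤-refl
  ... | no i≢j = <⇒≤ (s-strictMono i j (≤∧≢⇒< i≤j i≢j))

  s-reflects-≤ : ∀ i j → s i ≤ s j → i ≤ j
  s-reflects-≤ i j le with i ≤? j
  ... | yes p = p
  ... | no np = ⊥-elim (<⇒≱ (s-strictMono j i (≰⇒> np)) le)

  s-reflects-< : ∀ i j → s i < s j → i < j
  s-reflects-< i j lt with i <? j
  ... | yes p = p
  ... | no np = ⊥-elim (<⇒≱ lt (s-monotone (≮⇒≥ np)))

  s-injective : ∀ i j → s i ≡ s j → i ≡ j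
  s-injective i j e = ≤-antisym (s-reflects-≤ i j (≤-reflexive e)) (s-reflects-≤ j i (≤-reflexive (sym e)))

  n≤s : ∀ i → i ≤ s i
  n≤s zero = z≤n
  n≤s (suc i) = ≤-trans (s≤s (n≤s i)) (s-<-suc i)

  s-1≤2 : s 1 ≤ 2
  s-1≤2 = subst (_≤ 2) (sym (trans (s-suc 0) (trans (cong (_+ length (h (y 0))) s-zero) (length-h (y 0))))) (s≤s (ind≤1 b (y 0)))

  InUP-shorterThanImage : ∀ m → InUP y m → 2 < s m → m < s m
  InUP-shorterThanImage zero u _ = ⊥-elim (<-irrefl refl (proj₁ (InUP⇒borderFree y 0 u)))
  InUP-shorterThanImage (suc zero) _ 2<s1 = ⊥-elim (<⇒≱ 2<s1 s-1≤2)
  InUP-shorterThanImage (suc (suc m)) u _ =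
    subst (suc (suc m) <_) (sym (trans (s≡imgLength (suc (suc m))) (imgLength≡ 0 (suc (suc m))))) (m<m+n (suc (suc m)) containsB)
    where
    containsB : 1 ≤ cnt b y 0 (suc (suc m))
    containsB = ≤-trans (ind-distinct a (y 0) (y (suc m)) (λ q → InUP⇒last≢head y m u (sym q)))
                  (≤-trans (+-monoʳ-≤ (ind b (y 0)) (m≤n+m _ _))
                    (≤-reflexive (sym (trans (cnt-suc-left b y 0 (suc m)) (cong (ind b (y 0) +_) (cnt-suc-right b y 1 m))))))

  blockOf : ∀ p → ∃ λ i → ∃ λ r → r < length (h (y i)) × s i + r ≡ p
  blockOf zero = 0 , 0 , subst (0 <_) (sym (length-h (y 0))) (s≤s z≤n) , trans (+-identityʳ (s 0)) s-zero
  blockOf (suc p) with blockOf p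
  ... | i , r , r< , e with suc r <? length (h (y i))
  ... | yes lt = i , suc r , lt , trans (+-suc (s i) r) (cong suc e)
  ... | no nlt = suc i , 0 , subst (0 <_) (sym (length-h (y (suc i)))) (s≤s z≤n) ,
         trans (+-identityʳ _) (trans (s-suc i) (trans (cong (s i +_) (sym (≤-antisym r< (≮⇒≥ nlt)))) (trans (+-suc (s i) r) (cong suc e))))

  img-shift : ∀ i j k → fac y j k ≡ fac y i k → s (j + k) ≡ s j + imgLength i k × fac x (s j) (imgLength i k) ≡ fac x (s i) (imgLength i k)
  img-shift i j k e = trans (proj₂ (img-fac k j)) (cong (λ z → s j + length (img h z)) e) ,
     trans (cong (fac x (s j)) (cong (length ∘ img h) (sym e))) (trans (sym (proj₁ (img-fac k j)))
       (trans (cong (img h) e) (proj₁ (img-fac k i))))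

  count-block : ∀ k n L → s (k + n) ≡ s k + L → cnt b x (s k) L ≡ cnt b y k n
  count-block k n L e = trans (cong (cnt b x (s k)) (+-cancelˡ-≡ (s k) L (imgLength k n) (trans (sym e) (proj₂ (img-fac n k)))))
                   (trans (cong (count b) (sym (proj₁ (img-fac n k)))) (count-img (fac y k n)))

  border-image : ∀ m k → Border y m k → Border x (s m) (s k)
  border-image m k (0<k , k<m , eqs) = <-≤-trans 0<k (n≤s k) , s-strictMono k m k<m , eqx
    where
    j : ℕ
    j = m ∸ k
    jk : j + k ≡ m
    jk = m∸n+n≡m (<⇒≤ k<m)
    shifted : s (j + k) ≡ s j + imgLength 0 k × fac x (s j) (imgLength 0 k) ≡ fac x (s 0) (imgLength 0 k)
    shifted = img-shift 0 j k (fac-ext y y j 0 k (λ t t<k → sym (eqs t t<k)))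
    smk : s m ≡ s j + s k
    smk = trans (cong s (sym jk)) (trans (proj₁ shifted) (cong (s j +_) (sym (s≡imgLength k))))
    eqx : ∀ t → t < s k → x t ≡ x (s m ∸ s k + t)
    eqx t t< = trans (cong (λ z → x (z + t)) (sym s-zero))
                 (trans (sym (fac-ext⁻ x x (s j) (s 0) (imgLength 0 k) (proj₂ shifted) t (subst (t <_) (s≡imgLength k) t<)))
                   (cong (λ z → x (z + t)) (sym (trans (cong (_∸ s k) smk) (m+n∸n≡m (s j) (s k))))))

  InUP-preimage : ∀ m → InUP x (s m) → InUP y m
  InUP-preimage m u = borderFree⇒InUP y m 0<m λ k bk → proj₂ (InUP⇒borderFree x (s m) u) (s k) (border-image m k bk)
    where
    0<m : 0 < m
    0<m = s-reflects-< 0 m (subst (_< s m) (sym s-zero) (proj₁ (InUP⇒borderFree x _ u)))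

  -- The period p of y from m on gives the period |h(y[m, m + p))| of x from s m on.
  ultimatelyPeriodic-image : UltimatelyPeriodic y → UltimatelyPeriodic x
  ultimatelyPeriodic-image (p , 0<p , m , per) = imgLength m p , 0<period , s m , periodic
    where
    0<period : 0 < imgLength m p
    0<period = subst (0 <_) (sym (imgLength≡ m p)) (≤-trans 0<p (m≤m+n p _))
    periodic : ∀ n → s m ≤ n → x (n + imgLength m p) ≡ x n
    periodic n le = trans (cong x n+period≡) (trans (fac-ext⁻ x x (s (m + p)) (s m) (imgLength m k) (proj₂ shifted) t t<) (cong x (m+[n∸m]≡n le)))
      where
      k t : ℕ
      k = suc n
      t = n ∸ s m
      shifted : s (m + p + k) ≡ s (m + p) + imgLength m k × fac x (s (m + p)) (imgLength m k) ≡ fac x (s m) (imgLength m k)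
      shifted = img-shift m (m + p) k (fac-ext y y (m + p) m k (λ t _ → trans (cong y (swap₂₃ m p t)) (per (m + t) (m≤m+n m t))))
        where
        swap₂₃ : ∀ m p t → m + p + t ≡ m + t + p
        swap₂₃ = solve-∀
      t< : t < imgLength m k
      t< = subst (t <_) (sym (imgLength≡ m k)) (≤-trans (s≤s (m∸n≤m n (s m))) (m≤m+n k _))
      n+period≡ : n + imgLength m p ≡ s (m + p) + t
      n+period≡ = trans (cong (_+ imgLength m p) (sym (m+[n∸m]≡n le))) (trans (swap₂₃′ (s m) t (imgLength m p)) (cong (_+ t) (sym (proj₂ (img-fac p m)))))
        where
        swap₂₃′ : ∀ u v w → u + v + w ≡ u + w + v
        swap₂₃′ = solve-∀

  -- The letter y i is read at offset e of block i, and all blocks agree below that offset.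
  module UnborderedTransfer (e : ℕ) (letterInBlock : ∀ i → y i ≡ x (s i + e))
     (blocksAgree : ∀ i j q → q < e → x (s i + q) ≡ x (s j + q))
     (headLetter⇒blockStart : ∀ p → x p ≡ x 0 → ∃ λ j → s j ≡ p)
     (otherLetter⇒blockEnd : ∀ p → x p ≢ x 0 → ∃ λ j → s j ≡ suc p)
     (blockEnd-differs : ∀ i → y i ≢ y 0 → x (pred (s (suc i))) ≢ x 0)
     (longBlock-distinct : ∀ i → 1 < length (h (y i)) → x (s i) ≢ x (suc (s i))) where

    agreement-desubstitutes : ∀ j k → (∀ q → q < s k + e → x (s j + q) ≡ x q) → ∀ t → t ≤ k →
             (∀ t' → t' < t → y (j + t') ≡ y t') × s (j + t) ≡ s j + s t
    agreement-desubstitutes j k agree zero _ = (λ _ ()) , trans (cong s (+-identityʳ j)) (sym (trans (cong (s j +_) s-zero) (+-identityʳ _)))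
    agreement-desubstitutes j k agree (suc t) t<k = agreeY , aligned
      where
      IH : (∀ t' → t' < t → y (j + t') ≡ y t') × s (j + t) ≡ s j + s t
      IH = agreement-desubstitutes j k agree t (≤-trans (n≤1+n t) t<k)
      yj : y (j + t) ≡ y t
      yj = trans (letterInBlock (j + t)) (trans (cong (λ z → x (z + e)) (proj₂ IH))
             (trans (cong x (+-assoc (s j) (s t) e)) (trans (agree (s t + e) (+-monoˡ-< e (s-strictMono t k t<k))) (sym (letterInBlock t)))))
      agreeY : ∀ t' → t' < suc t → y (j + t') ≡ y t'
      agreeY t' (s≤s t'≤t) with t' ≟ t
      ... | yes refl = yj
      ... | no t'≢t = proj₁ IH t' (≤∧≢⇒< t'≤t t'≢t)
      aligned : s (j + suc t) ≡ s j + s (suc t)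
      aligned = trans (cong s (+-suc j t)) (trans (s-suc (j + t)) (trans (cong₂ _+_ (proj₂ IH) (cong (length ∘ h) yj))
             (trans (+-assoc (s j) (s t) _) (cong (s j +_) (sym (s-suc t))))))

    InUP-image-letter : InUP x (s 1)
    InUP-image-letter = borderFree⇒InUP x (s 1) (<-≤-trans (s≤s z≤n) (n≤s 1)) noBorder
      where
      s1≡ : s 1 ≡ length (h (y 0))
      s1≡ = trans (s-suc 0) (cong (_+ length (h (y 0))) s-zero)
      noBorder : ∀ K → Border x (s 1) K → ⊥
      noBorder (suc zero) (_ , 1<s1 , eqs) =
        longBlock-distinct 0 (subst (1 <_) s1≡ 1<s1) (trans (cong x s-zero) (trans (eqs 0 (s≤s z≤n)) (cong x secondPosition)))
        where
        secondPosition : s 1 ∸ 1 + 0 ≡ suc (s 0)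
        secondPosition = trans (+-identityʳ _) (trans (cong (_∸ 1) (≤-antisym s-1≤2 1<s1)) (cong suc (sym s-zero)))
      noBorder (suc (suc K)) (_ , K<s1 , _) = contradiction (≤-trans K<s1 s-1≤2) λ { (s≤s (s≤s ())) }

    border-desubstitutes : ∀ i → y i ≢ y 0 → ∀ K → Border x (s (suc i)) K → ∃ λ k → Border y (suc i) k
    border-desubstitutes i last≢head K (0<K , K<n , eqs) =
      k , 0<k , s-reflects-< k (suc i) (subst (_< n) (sym sk) K<n) ,
      λ t t<k → trans (sym (proj₁ lifted t t<k)) (cong (λ z → y (z + t)) (sym (trans (cong (_∸ k) (sym jk)) (m+n∸n≡m j k))))
      where
      n : ℕ
      n = s (suc i)
      start : ∃ λ j → s j ≡ n ∸ K
      start = headLetter⇒blockStart (n ∸ K) (trans (cong x (sym (+-identityʳ _))) (sym (eqs 0 0<K)))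
      j : ℕ
      j = proj₁ start
      Kpred : suc (pred K) ≡ K
      Kpred = suc-pred K {{>-nonZero 0<K}}
      eK : n ∸ K + pred K ≡ pred n
      eK = cong pred (trans (sym (+-suc (n ∸ K) (pred K))) (trans (cong (n ∸ K +_) Kpred) (m∸n+n≡m (<⇒≤ K<n))))
      end : ∃ λ k → s k ≡ suc (pred K)
      end = otherLetter⇒blockEnd (pred K) λ e' →
        blockEnd-differs i last≢head (trans (cong x (sym eK)) (trans (sym (eqs (pred K) (subst (pred K <_) Kpred ≤-refl))) e'))
      k : ℕ
      k = proj₁ end
      sk : s k ≡ K
      sk = trans (proj₂ end) Kpred
      sjk : s j + s k ≡ n
      sjk = trans (cong₂ _+_ (proj₂ start) sk) (m∸n+n≡m (<⇒≤ K<n))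
      agree : ∀ q → q < s k + e → x (s j + q) ≡ x q
      agree q q< with q <? s k
      ... | yes q<sk = trans (cong (λ z → x (z + q)) (proj₂ start)) (sym (eqs q (subst (q <_) sk q<sk)))
      ... | no q≮sk = trans (cong x e1) (trans (blocksAgree (suc i) k (q ∸ s k) (+-cancelˡ-< (s k) _ _ (subst (_< s k + e) (sym (m+[n∸m]≡n (≮⇒≥ q≮sk))) q<))) (cong x (m+[n∸m]≡n (≮⇒≥ q≮sk))))
        where
        e1 : s j + q ≡ n + (q ∸ s k)
        e1 = trans (cong (s j +_) (sym (m+[n∸m]≡n (≮⇒≥ q≮sk)))) (trans (sym (+-assoc (s j) (s k) _)) (cong (_+ (q ∸ s k)) sjk))
      lifted : (∀ t → t < k → y (j + t) ≡ y t) × s (j + k) ≡ s j + s k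
      lifted = agreement-desubstitutes j k agree k ≤-refl
      jk : j + k ≡ suc i
      jk = s-injective (j + k) (suc i) (trans (proj₂ lifted) sjk)
      0<k : 0 < k
      0<k = s-reflects-< 0 k (subst₂ _<_ (sym s-zero) (sym sk) 0<K)

    InUP-image : ∀ m → InUP y m → InUP x (s m)
    InUP-image zero u = ⊥-elim (<-irrefl refl (proj₁ (InUP⇒borderFree y 0 u)))
    InUP-image (suc zero) _ = InUP-image-letter
    InUP-image (suc (suc m)) u = borderFree⇒InUP x _ (<-≤-trans (s≤s z≤n) (n≤s (suc (suc m)))) λ K bK →
      uncurry (proj₂ (InUP⇒borderFree y _ u)) (border-desubstitutes (suc m) (InUP⇒last≢head y m u) K bK)

    img-pref : ∀ n → img h (pref y n) ≡ pref x (s n)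
    img-pref n = trans (isImage n) (cong (pref x) (sym (s≡imgLength n)))

    img-pref-injective : ∀ n n' → img h (pref y n) ≡ img h (pref y n') → n ≡ n'
    img-pref-injective n n' eq = s-injective n n'
      (trans (sym (length-pref x (s n))) (trans (cong length (trans (sym (img-pref n)) (trans eq (img-pref n')))) (length-pref x (s n'))))

    FiniteUP-preimage : FiniteUP x → FiniteUP y
    FiniteUP-preimage (B , bnd) = B , λ n u → ≤-trans (n≤s n) (bnd (s n) (InUP-image n u))

    sameDerived : FiniteUP x → ∃ λ d → IsDerived x d × IsDerived y d
    sameDerived finX with UPFactorization-exists y (FiniteUP-preimage finX)
    ... | ℓ , factY = code ℓ , (s ∘ ℓ , factX , λ i → sym (code-∘-injective s (λ {u} {v} → s-injective u v) ℓ i)) , (ℓ , factY , λ i → refl)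
      where
      imageOfFactor : ∀ i → s (pos ℓ i + ℓ i) ≡ s (pos ℓ i) + imgLength 0 (ℓ i)
                            × fac x (s (pos ℓ i)) (imgLength 0 (ℓ i)) ≡ fac x (s 0) (imgLength 0 (ℓ i))
      imageOfFactor i = img-shift 0 (pos ℓ i) (ℓ i) (proj₁ (factY i))
      pos-image : ∀ i → pos (s ∘ ℓ) i ≡ s (pos ℓ i)
      pos-image zero = sym s-zero
      pos-image (suc i) = trans (cong (_+ s (ℓ i)) (pos-image i))
        (sym (trans (proj₁ (imageOfFactor i)) (cong (s (pos ℓ i) +_) (sym (s≡imgLength (ℓ i))))))
      factX : UPFactorization x (s ∘ ℓ)
      factX i = trans (cong (λ z → fac x z (s (ℓ i))) (pos-image i))
                  (trans (cong (fac x (s (pos ℓ i))) (s≡imgLength (ℓ i))) (trans (proj₂ (imageOfFactor i))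
                    (trans (cong (λ z → fac x z (imgLength 0 (ℓ i))) s-zero) (cong (pref x) (sym (s≡imgLength (ℓ i))))))) ,
                InUP-image (ℓ i) (proj₂ (factY i))

    -- E selects the unbordered prefixes of x that are not images (none for L_a, the letter b for R_a).
    module Exclusion (E : List Bool → Set)
        (E-image : ∀ n → InUP y n → ¬ E (pref x (s n)))
        (E-length1 : ¬ E (pref x 1) → ∃ λ n → s n ≡ 1)
        (E-long : ∀ m → 1 < m → ¬ E (pref x m)) where

      InUP-hasPreimage : ∀ m → InUP x m → ¬ E (pref x m) → ∃ λ n → s n ≡ m
      InUP-hasPreimage zero u _ = ⊥-elim (<-irrefl refl (proj₁ (InUP⇒borderFree x 0 u)))
      InUP-hasPreimage (suc zero) _ ¬E = E-length1 ¬E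
      InUP-hasPreimage (suc (suc m)) u _ = otherLetter⇒blockEnd (suc m) (InUP⇒last≢head x m u)

      InUP-preimagePrefix : ∀ m → InUP x m → ¬ E (pref x m) → ∃ λ n → InUP y n × img h (pref y n) ≡ pref x m
      InUP-preimagePrefix m u ¬E with InUP-hasPreimage m u ¬E
      ... | n , refl = n , InUP-preimage n u , img-pref n

      upBijection : UPBijection h y x E
      upBijection = (λ n u → s n , InUP-image n u , E-image n u , img-pref n) , InUP-preimagePrefix ,
                    λ n n' _ _ → img-pref-injective n n'

      N-decreases : ∀ n → IsN x n → 2 < n → ∃ λ m → IsN y m × m < n
      N-decreases n (u , longest) 2<n with InUP-hasPreimage n u (E-long n (<-trans (s≤s (s≤s z≤n)) 2<n))
      ... | m , refl = m , (uY , longestY) , InUP-shorterThanImage m uY 2<n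
        where
        uY : InUP y m
        uY = InUP-preimage m u
        longestY : ∀ m' → InUP y m' → m' ≤ m
        longestY m' u' = s-reflects-≤ m' m (longest (s m') (InUP-image m' u'))

-- The morphisms L_a and R_a

La-a : ∀ a → La a a ≡ [ a ]
La-a false = refl
La-a true = refl

La-b : ∀ a → La a (not a) ≡ a ∷ not a ∷ []
La-b false = refl
La-b true = refl

Ra-a : ∀ a → Ra a a ≡ [ a ]
Ra-a false = refl
Ra-a true = refl

Ra-b : ∀ a → Ra a (not a) ≡ not a ∷ a ∷ []
Ra-b false = refl
Ra-b true = refl

lenLa : ∀ a c → length (La a c) ≡ suc (ind (not a) c)
lenLa false false = refl
lenLa false true = refl
lenLa true false = refl
lenLa true true = refl

lenRa : ∀ a c → length (Ra a c) ≡ suc (ind (not a) c)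
lenRa false false = refl
lenRa false true = refl
lenRa true false = refl
lenRa true true = refl

countLa : ∀ a → count (not a) (La a (not a)) ≡ 1
countLa false = refl
countLa true = refl

countRa : ∀ a → count (not a) (Ra a (not a)) ≡ 1
countRa false = refl
countRa true = refl

La-length : ∀ a c → length (La a c) ≡ 1 ⊎ length (La a c) ≡ 2
La-length false false = inj₁ refl
La-length false true = inj₂ refl
La-length true false = inj₂ refl
La-length true true = inj₁ refl

-- When N(x) = 2, δ(x) codes the block ab by 1 and the block a by 2.
La-codeLetter : Bool → Bool → ℕ
La-codeLetter a c = 3 ∸ length (La a c)

La-codeLetter-injective : ∀ a → Injective _≡_ _≡_ (La-codeLetter a)
La-codeLetter-injective false {false} {false} _ = refl
La-codeLetter-injective false {true} {true} _ = refl
La-codeLetter-injective true {false} {false} _ = refl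
La-codeLetter-injective true {true} {true} _ = refl
La-codeLetter-injective false {false} {true} ()
La-codeLetter-injective false {true} {false} ()
La-codeLetter-injective true {false} {true} ()
La-codeLetter-injective true {true} {false} ()

ind≡1⇒not : ∀ a c → ind (not a) c ≡ 1 → c ≡ not a
ind≡1⇒not false false ()
ind≡1⇒not false true _ = refl
ind≡1⇒not true false _ = refl
ind≡1⇒not true true ()

offsetInBlock : ∀ a c r → r < suc (ind (not a) c) → r ≡ 0 ⊎ (r ≡ 1 × c ≡ not a)
offsetInBlock a c zero _ = inj₁ refl
offsetInBlock a c (suc zero) (s≤s le) = inj₂ (refl , ind≡1⇒not a c (≤-antisym (ind≤1 (not a) c) le))
offsetInBlock a c (suc (suc r)) lt = ⊥-elim (bad (≤-trans (≤-pred lt) (ind≤1 (not a) c)))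
  where
  bad : suc (suc r) ≤ 1 → ⊥
  bad (s≤s ())

-- A longer prefix would end with a or with ab, and so have a border.
ab-prefix⇒shortUP : ∀ a x → x 0 ≡ a → x 1 ≡ not a → NoSquareOf (not a) x → ∀ n → InUP x n → n ≤ 2
ab-prefix⇒shortUP a x x0 x1 noBB zero _ = z≤n
ab-prefix⇒shortUP a x x0 x1 noBB (suc zero) _ = s≤s z≤n
ab-prefix⇒shortUP a x x0 x1 noBB (suc (suc zero)) _ = ≤-refl
ab-prefix⇒shortUP a x x0 x1 noBB (suc (suc (suc k))) u with x (suc (suc k)) ≟B a
... | yes last-a = ⊥-elim (InUP⇒last≢head x (suc k) u (trans last-a (sym x0)))
... | no last≢a = ⊥-elim (proj₂ (InUP⇒borderFree x _ u) 2 (s≤s z≤n , s≤s (s≤s (s≤s z≤n)) , border-ab))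
  where
  beforeLast : x (suc k) ≡ a
  beforeLast = ≢not⇒≡ (λ e → noBB (suc k) e (¬-not last≢a))
  border-ab : ∀ t → t < 2 → x t ≡ x (suc (suc (suc k)) ∸ 2 + t)
  border-ab zero _ = trans x0 (trans (sym beforeLast) (cong x (sym (+-identityʳ _))))
  border-ab (suc zero) _ = trans x1 (trans (sym (¬-not last≢a)) (cong x (sym (+-comm (suc k) 1))))
  border-ab (suc (suc t)) (s≤s (s≤s ()))

-- Blocks a and ab: y i is read just after the start of block i, where the next block begins
-- (with a) unless block i is ab.
module LaDesubstitution (a : Bool) (x : Word) (x0 : x 0 ≡ a) (noBB : NoSquareOf (not a) x) where
  b : Bool
  b = not a

  sL : ℕ → ℕ
  yL : Word
  sL zero = 0
  sL (suc i) = sL i + length (La a (yL i))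
  yL i = x (suc (sL i))

  block-a : ∀ i → yL i ≡ a → sL (suc i) ≡ suc (sL i)
  block-a i e = trans (cong (sL i +_) (trans (lenLa a (yL i)) (cong suc (ind-miss e)))) (+-comm (sL i) 1)

  block-b : ∀ i → yL i ≡ b → sL (suc i) ≡ suc (suc (sL i))
  block-b i e = trans (cong (sL i +_) (trans (lenLa a (yL i)) (cong suc (ind-hit e)))) (+-comm (sL i) 2)

  blockStart≡a : ∀ i → x (sL i) ≡ a
  blockStart≡a zero = x0
  blockStart≡a (suc i) with yL i ≟B a
  ... | yes e = trans (cong x (block-a i e)) e
  ... | no ne = trans (cong x (block-b i (¬-not ne))) (≢not⇒≡ (noBB (suc (sL i)) (¬-not ne)))

  blockAt : ∀ i → fac x (sL i) (length (La a (yL i))) ≡ La a (yL i)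
  blockAt i = blockAt-letter (yL i) refl
    where
    blockAt-letter : ∀ c → yL i ≡ c → fac x (sL i) (length (La a c)) ≡ La a c
    blockAt-letter c e with c ≟B a
    ... | yes refl rewrite La-a a = trans (fac1 x (sL i)) (cong [_] (blockStart≡a i))
    ... | no ne with ¬-not ne
    ... | refl rewrite La-b a = trans (fac2 x (sL i)) (cong₂ _∷_ (blockStart≡a i) (cong [_] e))

  open Desubstitution a (La a) (La-a a) (cong length (La-b a)) (countLa a) x yL sL refl (λ i → refl) blockAt public hiding (b)

  offset : ∀ i r → r < length (La a (yL i)) → r ≡ 0 ⊎ (r ≡ 1 × yL i ≡ b)
  offset i r lt = offsetInBlock a (yL i) r (subst (r <_) (lenLa a (yL i)) lt)

  headLetter⇒blockStart : ∀ p → x p ≡ x 0 → ∃ λ j → sL j ≡ p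
  headLetter⇒blockStart p e with blockOf p
  ... | i , r , r< , ep with offset i r r<
  ... | inj₁ refl = i , trans (sym (+-identityʳ _)) ep
  ... | inj₂ (refl , yb) = ⊥-elim (not-¬ {a} refl (trans (sym (trans e x0)) (trans (cong x (trans (sym ep) (+-comm (sL i) 1))) yb)))

  otherLetter⇒blockEnd : ∀ p → x p ≢ x 0 → ∃ λ j → sL j ≡ suc p
  otherLetter⇒blockEnd p ne with blockOf p
  ... | i , r , r< , ep with offset i r r<
  ... | inj₁ refl = ⊥-elim (ne (trans (cong x (trans (sym ep) (+-identityʳ _))) (trans (blockStart≡a i) (sym x0))))
  ... | inj₂ (refl , yb) = suc i , trans (block-b i yb) (cong suc (trans (+-comm 1 (sL i)) ep))

  longBlock-distinct : ∀ i → 1 < length (La a (yL i)) → x (sL i) ≢ x (suc (sL i))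
  longBlock-distinct i lt e with offset i 1 lt
  ... | inj₁ ()
  ... | inj₂ (_ , yb) = not-¬ {a} refl (trans (sym (blockStart≡a i)) (trans e yb))

  blocksAgree : ∀ i j q → q < 1 → x (sL i + q) ≡ x (sL j + q)
  blocksAgree i j zero _ = trans (cong x (+-identityʳ _)) (trans (blockStart≡a i) (trans (sym (blockStart≡a j)) (cong x (sym (+-identityʳ _)))))
  blocksAgree i j (suc q) (s≤s ())

  letterInBlock : ∀ i → yL i ≡ x (sL i + 1)
  letterInBlock i = cong x (+-comm 1 (sL i))

  -- b·h(w)·ab and a·h(w)·aa are factors of x of the same length whose numbers of b differ by 2.
  unbalanced-image : UnbalancedFactor.MinimalUnbalancedPair a yL → ¬ Balanced x
  unbalanced-image (i , j , m , yi , yim , yj , yjm , agree) bx = ∣2+c-c∣≰1 cw (subst₂ (λ u v → ∣ u - v ∣ ≤ 1) bSide aSide (bx b (suc (sL i)) (sL j) (suc (Lw + 2))))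
    where
    Lw cw : ℕ
    Lw = imgLength (suc i) m
    cw = cnt b yL (suc i) m
    shI : sL (suc i + m) ≡ sL (suc i) + Lw
    shI = proj₂ (img-fac m (suc i))
    shJ : sL (suc j + m) ≡ sL (suc j) + Lw
    shJ = proj₁ (img-shift (suc i) (suc j) m (fac-ext yL yL (suc j) (suc i) m (λ t t< → sym (agree t t<))))
    cI : cnt b x (sL (suc i)) Lw ≡ cw
    cI = count-block (suc i) m Lw shI
    cJ : cnt b x (sL (suc j)) Lw ≡ cw
    cJ = trans (count-block (suc j) m Lw shJ) (cong (count b) (fac-ext yL yL (suc j) (suc i) m (λ t t< → sym (agree t t<))))
    endI : cnt b x (sL (suc i + m)) 2 ≡ 1
    endI = trans (cnt-2 b x _) (cong₂ _+_ (ind-miss (blockStart≡a (suc i + m))) (ind-hit yim))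
    endJ : cnt b x (sL (suc j + m)) 2 ≡ 0
    endJ = trans (cnt-2 b x _) (cong₂ _+_ (ind-miss (blockStart≡a (suc j + m))) (ind-miss yjm))
    bSide : cnt b x (suc (sL i)) (suc (Lw + 2)) ≡ suc (suc cw)
    bSide = trans (cnt-suc-left b x (suc (sL i)) (Lw + 2)) (cong₂ _+_ (ind-hit yi)
           (trans (cong (λ z → cnt b x z (Lw + 2)) (sym (block-b i yi))) (trans (cnt-+ b x (sL (suc i)) Lw 2)
             (trans (cong₂ _+_ cI (trans (cong (λ z → cnt b x z 2) (sym shI)) endI)) (+-comm cw 1)))))
    aSide : cnt b x (sL j) (suc (Lw + 2)) ≡ cw
    aSide = trans (cnt-suc-left b x (sL j) (Lw + 2)) (cong₂ _+_ (ind-miss (blockStart≡a j))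
           (trans (cong (λ z → cnt b x z (Lw + 2)) (sym (block-a j yj))) (trans (cnt-+ b x (sL (suc j)) Lw 2)
             (trans (cong₂ _+_ cJ (trans (cong (λ z → cnt b x z 2) (sym shJ)) endJ)) (+-identityʳ cw)))))

  sturmian-preimage : Sturmian x → Sturmian yL
  sturmian-preimage (ap , bx) = (λ py → ap (ultimatelyPeriodic-image py)) , UnbalancedFactor.noPair⇒balanced a yL (λ mp → unbalanced-image mp bx)

-- Blocks a and ba: y i is the first letter of block i.
module RaDesubstitution (a : Bool) (x : Word) (x0 : x 0 ≡ not a) (noBB : NoSquareOf (not a) x) where
  b : Bool
  b = not a

  sR : ℕ → ℕ
  yR : Word
  sR zero = 0
  sR (suc i) = sR i + length (Ra a (yR i))
  yR i = x (sR i)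

  block-a : ∀ i → yR i ≡ a → sR (suc i) ≡ suc (sR i)
  block-a i e = trans (cong (sR i +_) (trans (lenRa a (yR i)) (cong suc (ind-miss e)))) (+-comm (sR i) 1)

  block-b : ∀ i → yR i ≡ b → sR (suc i) ≡ suc (suc (sR i))
  block-b i e = trans (cong (sR i +_) (trans (lenRa a (yR i)) (cong suc (ind-hit e)))) (+-comm (sR i) 2)

  blockAt : ∀ i → fac x (sR i) (length (Ra a (yR i))) ≡ Ra a (yR i)
  blockAt i = blockAt-letter (yR i) refl
    where
    blockAt-letter : ∀ c → yR i ≡ c → fac x (sR i) (length (Ra a c)) ≡ Ra a c
    blockAt-letter c e with c ≟B a
    ... | yes refl rewrite Ra-a a = trans (fac1 x (sR i)) (cong [_] e)
    ... | no ne with ¬-not ne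
    ... | refl rewrite Ra-b a = trans (fac2 x (sR i)) (cong₂ _∷_ e (cong [_] (≢not⇒≡ (noBB (sR i) e))))

  open Desubstitution a (Ra a) (Ra-a a) (cong length (Ra-b a)) (countRa a) x yR sR refl (λ i → refl) blockAt public hiding (b)

  offset : ∀ i r → r < length (Ra a (yR i)) → r ≡ 0 ⊎ (r ≡ 1 × yR i ≡ b)
  offset i r lt = offsetInBlock a (yR i) r (subst (r <_) (lenRa a (yR i)) lt)

  blockEnd≡a : ∀ i → x (pred (sR (suc i))) ≡ a
  blockEnd≡a i with yR i ≟B a
  ... | yes e = trans (cong (x ∘ pred) (block-a i e)) e
  ... | no ne = trans (cong (x ∘ pred) (block-b i (¬-not ne))) (≢not⇒≡ (noBB (sR i) (¬-not ne)))

  headLetter⇒blockStart : ∀ p → x p ≡ x 0 → ∃ λ j → sR j ≡ p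
  headLetter⇒blockStart p e with blockOf p
  ... | i , r , r< , ep with offset i r r<
  ... | inj₁ refl = i , trans (sym (+-identityʳ _)) ep
  ... | inj₂ (refl , yb) = ⊥-elim (noBB (sR i) yb (trans (cong x (trans (+-comm 1 (sR i)) ep)) (trans e x0)))

  otherLetter⇒blockEnd : ∀ p → x p ≢ x 0 → ∃ λ j → sR j ≡ suc p
  otherLetter⇒blockEnd p ne with blockOf p
  ... | i , r , r< , ep with offset i r r<
  ... | inj₁ refl = suc i , trans (block-a i (≢not⇒≡ (λ q → ne (trans (cong x (sym (trans (sym (+-identityʳ _)) ep))) (trans q (sym x0)))))) (cong suc (trans (sym (+-identityʳ _)) ep))
  ... | inj₂ (refl , yb) = suc i , trans (block-b i yb) (cong suc (trans (+-comm 1 (sR i)) ep))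

  blockEnd-differs : ∀ i → yR i ≢ yR 0 → x (pred (sR (suc i))) ≢ x 0
  blockEnd-differs i _ e = not-¬ {a} refl (trans (sym (blockEnd≡a i)) (trans e x0))

  longBlock-distinct : ∀ i → 1 < length (Ra a (yR i)) → x (sR i) ≢ x (suc (sR i))
  longBlock-distinct i lt e with offset i 1 lt
  ... | inj₁ ()
  ... | inj₂ (_ , yb) = noBB (sR i) yb (trans (sym e) yb)

  blocksAgree : ∀ i j q → q < 0 → x (sR i + q) ≡ x (sR j + q)
  blocksAgree i j q ()

  letterInBlock : ∀ i → yR i ≡ x (sR i + 0)
  letterInBlock i = cong x (sym (+-identityʳ _))

  -- ba·h(w)·b and aa·h(w)·a are factors of x of the same length whose numbers of b differ by 2.
  unbalanced-image : UnbalancedFactor.MinimalUnbalancedPair a yR → ¬ Balanced x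
  unbalanced-image (i , zero , m , yi , yim , yj , yjm , agree) bx = not-¬ {a} refl (trans (sym yj) x0)
  unbalanced-image (i , suc j' , m , yi , yim , yj , yjm , agree) bx = ∣2+c-c∣≰1 cw (subst₂ (λ u v → ∣ u - v ∣ ≤ 1) bSide aSide (bx b (sR i) (pred (sR j)) (suc (suc (Lw + 1)))))
    where
    j Lw cw : ℕ
    j = suc j'
    Lw = imgLength (suc i) m
    cw = cnt b yR (suc i) m
    shI : sR (suc i + m) ≡ sR (suc i) + Lw
    shI = proj₂ (img-fac m (suc i))
    shJ : sR (suc j + m) ≡ sR (suc j) + Lw
    shJ = proj₁ (img-shift (suc i) (suc j) m (fac-ext yR yR (suc j) (suc i) m (λ t t< → sym (agree t t<))))
    cI : cnt b x (sR (suc i)) Lw ≡ cw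
    cI = count-block (suc i) m Lw shI
    cJ : cnt b x (sR (suc j)) Lw ≡ cw
    cJ = trans (count-block (suc j) m Lw shJ) (cong (count b) (fac-ext yR yR (suc j) (suc i) m (λ t t< → sym (agree t t<))))
    tailI : cnt b x (sR (suc i)) (Lw + 1) ≡ suc cw
    tailI = trans (cong (cnt b x (sR (suc i))) (+-comm Lw 1)) (trans (cnt-suc-right b x (sR (suc i)) Lw)
              (trans (cong₂ _+_ cI (trans (cong (ind b ∘ x) (sym shI)) (ind-hit yim))) (+-comm cw 1)))
    bSide : cnt b x (sR i) (suc (suc (Lw + 1))) ≡ suc (suc cw)
    bSide = trans (cnt-suc-left b x (sR i) _) (cong₂ _+_ (ind-hit yi)
           (trans (cnt-suc-left b x (suc (sR i)) _) (cong₂ _+_ (ind-miss (≢not⇒≡ (noBB (sR i) yi)))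
             (trans (cong (λ z → cnt b x z (Lw + 1)) (sym (block-b i yi))) tailI))))
    pj : suc (pred (sR j)) ≡ sR j
    pj = suc-pred (sR j) {{>-nonZero (≤-trans (s≤s z≤n) (n≤s j))}}
    tailJ : cnt b x (sR (suc j)) (Lw + 1) ≡ cw
    tailJ = trans (cong (cnt b x (sR (suc j))) (+-comm Lw 1)) (trans (cnt-suc-right b x (sR (suc j)) Lw)
              (trans (cong₂ _+_ cJ (trans (cong (ind b ∘ x) (sym shJ)) (ind-miss yjm))) (+-identityʳ cw)))
    aSide : cnt b x (pred (sR j)) (suc (suc (Lw + 1))) ≡ cw
    aSide = trans (cnt-suc-left b x (pred (sR j)) _) (cong₂ _+_ (ind-miss (blockEnd≡a j'))
           (trans (cong (λ z → cnt b x z (suc (Lw + 1))) pj) (trans (cnt-suc-left b x (sR j) _) (cong₂ _+_ (ind-miss yj)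
             (trans (cong (λ z → cnt b x z (Lw + 1)) (sym (block-a j yj))) tailJ)))))

  sturmian-preimage : Sturmian x → Sturmian yR
  sturmian-preimage (ap , bx) = (λ py → ap (ultimatelyPeriodic-image py)) , UnbalancedFactor.noPair⇒balanced a yR (λ mp → unbalanced-image mp bx)

N≤2⇒startsWith-ab : ∀ a x → ¬ UltimatelyPeriodic x → ContainsSquareOf a x → (∀ m → InUP x m → m ≤ 2) →
  x 0 ≡ a × x 1 ≡ not a
N≤2⇒startsWith-ab a x aperiodic sq short = startsWith-a , secondLetter
  where
  tooLong : ∀ k → InUP x (3 + k) → ⊥
  tooLong k u = contradiction (short (3 + k) u) λ { (s≤s (s≤s ())) }

  -- Otherwise the prefix ending with the first aa would be a longer unbordered prefix.
  startsWith-a : x 0 ≡ a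
  startsWith-a with x 0 ≟B a
  ... | yes x0a = x0a
  ... | no x0≢a with least (λ s → (x s ≟B a) ×-dec (x (suc s) ≟B a)) (proj₁ sq) (proj₂ sq)
  ...   | zero , _ , (x0a , _) , _ = ⊥-elim (x0≢a x0a)
  ...   | suc k , _ , (xk , xk') , first = ⊥-elim (tooLong k (prefixToFirstSquare-unbordered a x (suc k) x0≢a xk xk' first))

  -- Otherwise the prefix ending with the first b would be a longer unbordered prefix.
  noOtherAfter-aa : x 1 ≡ a → ∀ t → x t ≢ not a
  noOtherAfter-aa x1a t xt with least (λ s → x s ≟B not a) t xt
  ... | zero , _ , x0b , _ = not-¬ {a} refl (trans (sym startsWith-a) x0b)
  ... | suc zero , _ , x1b , _ = not-¬ {a} refl (trans (sym x1a) x1b)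
  ... | suc (suc k) , _ , xb , first =
    tooLong k (prefixToFirstLetter-unbordered x (suc (suc k)) λ s s<t e → first s s<t (trans e xb))

  secondLetter : x 1 ≡ not a
  secondLetter with x 1 ≟B a
  ... | no x1≢a = ¬-not x1≢a
  ... | yes x1a = ⊥-elim (aperiodic (1 , s≤s z≤n , 0 , λ t _ → trans (constant (t + 1)) (sym (constant t))))
    where
    constant : ∀ t → x t ≡ a
    constant t = ≢not⇒≡ (noOtherAfter-aa x1a t)

La-derivedWord : ∀ a x (x0 : x 0 ≡ a) → x 1 ≡ not a → (noBB : NoSquareOf (not a) x) →
  ∃[ d ] (IsDerived x d × WordIso (LaDesubstitution.yL a x x0 noBB) d)
La-derivedWord a x x0 x1 noBB = code blockLength , (blockLength , blocks , λ i → refl) , iso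
  where
  module L = LaDesubstitution a x x0 noBB

  blockLength : ℕ → ℕ
  blockLength i = length (La a (L.yL i))

  pos≡sL : ∀ i → pos blockLength i ≡ L.sL i
  pos≡sL zero = refl
  pos≡sL (suc i) = cong (_+ blockLength i) (pos≡sL i)

  La-prefix : ∀ c → pref x (length (La a c)) ≡ La a c × InUP x (length (La a c))
  La-prefix c with c ≟B a
  ... | yes refl rewrite La-a a = cong [_] x0 , InUP-1 x
  ... | no c≢a with ¬-not c≢a
  ... | refl rewrite La-b a = cong₂ _∷_ x0 (cong [_] x1) , InUP-2
    where
    InUP-2 : InUP x 2
    InUP-2 = borderFree⇒InUP x 2 (s≤s z≤n) λ
      { (suc zero) (_ , _ , eqs) → not-¬ {a} refl (trans (sym x0) (trans (eqs 0 (s≤s z≤n)) x1))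
      ; (suc (suc K)) (_ , s≤s (s≤s ()) , _) }

  blocks : UPFactorization x blockLength
  blocks i = trans (cong (λ z → fac x z (blockLength i)) (pos≡sL i)) (trans (L.blockAt i) (sym (proj₁ (La-prefix (L.yL i))))) ,
             proj₂ (La-prefix (L.yL i))

  iso : WordIso L.yL (code blockLength)
  iso = La-codeLetter a , La-codeLetter-injective a ,
        code-of-lengths-1-2 blockLength (λ t → La-length a (L.yL t)) (trans (cong (length ∘ La a) x1) (cong length (La-b a)))

part-i : (a : Bool) (x : Word) → Sturmian x → ContainsSquareOf a x → FiniteUP x →
      ∀ n → IsN x n → n ≡ 2 →
          ∃[ y ] (Sturmian y × (∃[ d ] (IsDerived x d × WordIso y d)) × IsImage (La a) y x)
part-i a x st@(aperiodic , balanced) sq _ n (_ , longest) refl with N≤2⇒startsWith-ab a x aperiodic sq longest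
... | x0a , x1b = L.yL , L.sturmian-preimage st , La-derivedWord a x x0a x1b noBB , L.isImage
  where
  noBB : NoSquareOf (not a) x
  noBB = noSquareOfOther a x balanced sq
  module L = LaDesubstitution a x x0a noBB

part-ii : (a : Bool) (x : Word) → Sturmian x → ContainsSquareOf a x → FiniteUP x →
      ∀ n → IsN x n → 2 < n → x 0 ≡ a →
          ∃[ y ] (Sturmian y × y 0 ≡ a × IsImage (La a) y x
                  × (∃[ m ] (IsN y m × m < n))
                  × (∃[ d ] (IsDerived x d × IsDerived y d))
                  × UPBijection (La a) y x NoExclusion)
part-ii a x st@(_ , balanced) sq fin n isN@(unbordered , _) 2<n x0a =
  L.yL , L.sturmian-preimage st , x1a , L.isImage , F.N-decreases n isN 2<n , T.sameDerived fin , F.upBijection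
  where
  noBB : NoSquareOf (not a) x
  noBB = noSquareOfOther a x balanced sq
  x1a : x 1 ≡ a
  x1a = ≢not⇒≡ λ x1b → <⇒≱ 2<n (ab-prefix⇒shortUP a x x0a x1b noBB n unbordered)
  module L = LaDesubstitution a x x0a noBB
  blockEnd-differs : ∀ i → L.yL i ≢ L.yL 0 → x (pred (L.sL (suc i))) ≢ x 0
  blockEnd-differs i yi≢y0 e = not-¬ {a} refl (trans (sym x0a) (trans (sym e) (trans (cong (x ∘ pred) (L.block-b i yi≡b)) yi≡b)))
    where
    yi≡b : L.yL i ≡ not a
    yi≡b = ¬-not (λ q → yi≢y0 (trans q (sym x1a)))
  module T = L.UnborderedTransfer 1 L.letterInBlock L.blocksAgree L.headLetter⇒blockStart L.otherLetter⇒blockEnd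
               blockEnd-differs L.longBlock-distinct
  module F = T.Exclusion NoExclusion (λ _ _ ()) (λ _ → 1 , L.block-a 0 x1a) (λ _ _ ())

part-iii : (a : Bool) (x : Word) → Sturmian x → ContainsSquareOf a x → FiniteUP x →
      ∀ n → IsN x n → 2 < n → x 0 ≡ not a →
          ∃[ y ] (Sturmian y × y 0 ≡ not a × IsImage (Ra a) y x
                  × (∃[ m ] (IsN y m × m < n))
                  × (∃[ d ] (IsDerived x d × IsDerived y d))
                  × UPBijection (Ra a) y x (λ w → w ≡ [ not a ]))
part-iii a x st@(_ , balanced) sq fin n isN 2<n x0b =
  R.yR , R.sturmian-preimage st , x0b , R.isImage , F.N-decreases n isN 2<n , T.sameDerived fin , F.upBijection
  where
  module R = RaDesubstitution a x x0b (noSquareOfOther a x balanced sq)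
  length≢1 : ∀ m → m ≢ 1 → pref x m ≢ [ not a ]
  length≢1 m m≢1 e = m≢1 (trans (sym (length-pref x m)) (cong length e))
  imageLength≥2 : ∀ n → InUP R.yR n → R.sR n ≢ 1
  imageLength≥2 n u e = <⇒≢ (≤-trans (≤-reflexive (sym (R.block-b 0 x0b))) (R.s-monotone (proj₁ (InUP⇒borderFree R.yR n u)))) (sym e)
  module T = R.UnborderedTransfer 0 R.letterInBlock R.blocksAgree R.headLetter⇒blockStart R.otherLetter⇒blockEnd
               R.blockEnd-differs R.longBlock-distinct
  module F = T.Exclusion (λ w → w ≡ [ not a ]) (λ n u → length≢1 (R.sR n) (imageLength≥2 n u))
               (λ ne → ⊥-elim (ne (cong [_] x0b))) (λ m 1<m → length≢1 m (>⇒≢ 1<m))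

mainTheorem15 : (a : Bool) (x : Word) → Sturmian x → ContainsSquareOf a x → FiniteUP x →
    ((∀ n → IsN x n → n ≡ 2 →
        ∃[ y ] (Sturmian y × (∃[ d ] (IsDerived x d × WordIso y d)) × IsImage (La a) y x))
    × (∀ n → IsN x n → 2 < n → x 0 ≡ a →
        ∃[ y ] (Sturmian y × y 0 ≡ a × IsImage (La a) y x
                × (∃[ m ] (IsN y m × m < n))
                × (∃[ d ] (IsDerived x d × IsDerived y d))
                × UPBijection (La a) y x NoExclusion))
    × (∀ n → IsN x n → 2 < n → x 0 ≡ not a →
        ∃[ y ] (Sturmian y × y 0 ≡ not a × IsImage (Ra a) y x
                × (∃[ m ] (IsN y m × m < n))
                × (∃[ d ] (IsDerived x d × IsDerived y d))
                × UPBijection (Ra a) y x (λ w → w ≡ [ not a ]))))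
mainTheorem15 a x st sq fin = part-i a x st sq fin , part-ii a x st sq fin , part-iii a x st sq fin
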